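{- Let $\mathbf O$ be an orthogonal spread in $\overline V=V^+(2n+2,2)$. Let $N$ be a nonsingular point and $P$ a singular point of $\overline V$ such that the $2$-space $\langle N,P\rangle$ is hyperbolic. Then the dual hyperoval $\mathbf O/P$ is (after identifying the underlying spaces by a suitable isometry) a shadow of the symplectic spread $\mathbf O/N$.
   Context: $V^+(2m,2)$: $2m$-dimensional $\mathbb F_2$-space with nondegenerate quadratic form $Q$ of plus type; a point $\langle v\rangle$ is singular if $Q(v)=0$; a 2-space is hyperbolic if it contains exactly two singular points. An orthogonal spread of $\overline V$ is a set of totally singular $(n+1)$-spaces such that each nonzero singular vector lies in exactly one of them. For a singular point $P$ lying in $Y\in\mathbf O$, $\mathbf O/P=\{\langle X\cap P^\perp,P\rangle/P\mid X\in\mathbf O-\{Y\}\}$, an orthogonal dual hyperoval in $P^\perp/P\simeq V^+(2n,2)$. For a nonsingular point $N$, $N^\perp/N$ is a $2n$-dimensional symplectic space and $\mathbf O/N=\{\langle X\cap N^\perp,N\rangle/N\mid X\in\mathbf O\}$ is a symplectic spread there. Shadow: for a symplectic spread $\mathbf S$ of a symplectic space $V$ and $X,Y\in\mathbf S$, identify $V=U\oplus U$ ($U=V(n,2)$ with nondegenerate symmetric form $\mathsf b$) with $X=U\oplus0$, $Y=0\oplus U$, alternating form $((x,y),(x',y'))=\mathsf b(x,y')+\mathsf b(y,x')$, so that $\mathbf S=\{V(L)\mid L\in\Sigma\}\cup\{Y\}$ with $V(L)=\{(x,xL)\}$ and $\Sigma$ a set of self-adjoint operators. With $xE_{a,b}=\mathsf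 b(x,a)b$ and $C:U\to\Sigma$ the unique bijection with $C(a)+E_{a,a}$ skew-symmetric, the DHO $\{V(C(a)+E_{a,a})\mid a\in U\}$ in $V$ with quadratic form $Q(x,y)=\mathsf b(x,y)$ is called a shadow of $\mathbf S$. -}

module Defs where

open import Data.Bool using (Bool; true; false; _xor_; _∧_; if_then_else_)
open import Data.Nat using (ℕ; zero; suc)
open import Data.Fin using (Fin; zero; suc)
open import Data.Vec using (Vec; []; _∷_; zipWith; foldr; replicate; map)
open import Data.Product using (Σ; ∃; _×_; _,_; ∃-syntax; proj₁; proj₂)
open import Data.Sum using (_⊎_)
open import Relation.Binary.PropositionalEquality using (_≡_; _≢_)
open import Relation.Nullary using (¬_)

F2^ : ℕ → Set
F2^ m = Vec Bool m

0ᵥ : ∀ {m} → F2^ m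
0ᵥ = replicate _ false

_+ᵥ_ : ∀ {m} → F2^ m → F2^ m → F2^ m
_+ᵥ_ = zipWith _xor_

_·ᵥ_ : ∀ {m} → Bool → F2^ m → F2^ m
c ·ᵥ x = map (c ∧_) x

dot : ∀ {m} → F2^ m → F2^ m → Bool
dot x y = foldr _ _xor_ false (zipWith _∧_ x y)

-- V^+(2k,2) in standard (hyperbolic) coordinates: F_2^k ⊕ F_2^k with
-- quadratic form Q(u,w) = u·w (the nondegenerate quadratic form of plus
-- type, unique up to isometry) and its polar form B.

H : ℕ → Set
H k = F2^ k × F2^ k

0H : ∀ {k} → H k
0H = 0ᵥ , 0ᵥ

_+H_ : ∀ {k} → H k → H k → H k
(u , w) +H (u' , w') = (u +ᵥ u') , (w +ᵥ w')

_·H_ : ∀ {k} → Bool → H k → H k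
c ·H (u , w) = (c ·ᵥ u) , (c ·ᵥ w)

Q : ∀ {k} → H k → Bool
Q (u , w) = dot u w

Bf : ∀ {k} → H k → H k → Bool
Bf (u , w) (u' , w') = dot u w' xor dot w u'

-- Subspaces, given by a spanning family e : Fin d → H k

lincomb : ∀ {d k} → (Fin d → Bool) → (Fin d → H k) → H k
lincomb {zero}  c e = 0H
lincomb {suc d} c e = (c zero ·H e zero) +H lincomb (λ i → c (suc i)) (λ i → e (suc i))

InSpan : ∀ {d k} → (Fin d → H k) → H k → Set
InSpan e v = ∃[ c ] lincomb c e ≡ v

LinIndep : ∀ {d k} → (Fin d → H k) → Set
LinIndep e = ∀ c → lincomb c e ≡ 0H → ∀ i → c i ≡ false

Nonzero : ∀ {k} → H k → Set
Nonzero v = ¬ (v ≡ 0H)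

TotallySingular : ∀ {d k} → (Fin d → H k) → Set
TotallySingular e = ∀ v → InSpan e v → Q v ≡ false

Perp : ∀ {k} → H k → H k → Set
Perp c v = Bf v c ≡ false

-- points (over F_2 a point ⟨v⟩ is the same as a nonzero vector v)
SingularPoint : ∀ {k} → H k → Set
SingularPoint v = Nonzero v × Q v ≡ false

NonsingularPoint : ∀ {k} → H k → Set
NonsingularPoint v = Nonzero v × Q v ≡ true

pair : ∀ {k} → H k → H k → Fin 2 → H k
pair x y zero = x
pair x y (suc _) = y

Hyperbolic2Space : ∀ {k} → (Fin 2 → H k) → Set
Hyperbolic2Space e =
  LinIndep e ×
  ∃[ s ] ∃[ t ] (InSpan e s × SingularPoint s × InSpan e t × SingularPoint t × s ≢ t ×
    (∀ v → InSpan e v → SingularPoint v → v ≡ s ⊎ v ≡ t))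

-- Orthogonal spread of V^+(2n+2,2): a set (injectively indexed family)
-- of totally singular (n+1)-spaces such that every nonzero singular
-- vector lies in exactly one member.  (Injectivity of the indexing
-- follows from `unique`.)

record OrthogonalSpread (n : ℕ) : Set where
  field
    size    : ℕ
    member  : Fin size → (Fin (suc n) → H (suc n))
    indep   : ∀ i → LinIndep (member i)
    totSing : ∀ i → TotallySingular (member i)
    cover   : ∀ v → SingularPoint v → ∃[ i ] InSpan (member i) v
    unique  : ∀ v → SingularPoint v → ∀ i j →
              InSpan (member i) v → InSpan (member j) v → i ≡ j

SameSet : ∀ {k} → (H k → Set) → (H k → Set) → Set
SameSet A C = ∀ v → (A v → C v) × (C v → A v)

-- h( X ∩ c^⊥ ), the image of X ∩ c^⊥ under h; when h is the
-- (coordinatised) quotient map c^⊥ → c^⊥/c with kernel ⟨c⟩ this is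
-- ⟨X ∩ c^⊥, c⟩ / c.
Img : ∀ {d k m} → (H k → H m) → (Fin d → H k) → H k → H m → Set
Img h e c w = ∃[ u ] InSpan e u × Perp c u × h u ≡ w

record SymForm (n : ℕ) : Set where
  field
    b        : F2^ n → F2^ n → Bool
    additive : ∀ x x' y → b (x +ᵥ x') y ≡ b x y xor b x' y
    symm     : ∀ x y → b x y ≡ b y x
    nondeg   : ∀ x → ¬ (x ≡ 0ᵥ) → ∃[ y ] b x y ≡ true

module _ {n : ℕ} (β : SymForm n) where
  open SymForm β

  Bsymp : H n → H n → Bool
  Bsymp (x , y) (x' , y') = b x y' xor b y x'

  Qb : H n → Bool
  Qb (x , y) = b x y

  E : F2^ n → F2^ n → F2^ n
  E a x = if b x a then a else 0ᵥ

  Graph : (F2^ n → F2^ n) → H n → Set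
  Graph L (x , y) = y ≡ L x

  -- (operator) skew-symmetric w.r.t. b in characteristic 2: b(x, xM) = 0
  Alternating : (F2^ n → F2^ n) → Set
  Alternating M = ∀ x → b x (M x) ≡ false

  -- g : N^⊥ → U ⊕ U realises an isometry of symplectic spaces N^⊥/N ≅ U ⊕ U
  -- (extended additively to all of V̄; only its values on N^⊥ matter)
  SymplecticCoord : ∀ {k} → H k → (H k → H n) → Set
  SymplecticCoord N g =
    (∀ u v → g (u +H v) ≡ g u +H g v) ×
    (∀ v → Perp N v → (g v ≡ 0H → v ≡ 0H ⊎ v ≡ N) × (v ≡ 0H ⊎ v ≡ N → g v ≡ 0H)) ×
    (∀ w → ∃[ v ] Perp N v × g v ≡ w) ×
    (∀ u v → Perp N u → Perp N v → Bsymp (g u) (g v) ≡ Bf u v)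

  -- f : P^⊥ → U ⊕ U realises an isometry of quadratic spaces
  -- P^⊥/P ≅ (U ⊕ U, Qb)
  QuadraticCoord : ∀ {k} → H k → (H k → H n) → Set
  QuadraticCoord P f =
    (∀ u v → f (u +H v) ≡ f u +H f v) ×
    (∀ v → Perp P v → (f v ≡ 0H → v ≡ 0H ⊎ v ≡ P) × (v ≡ 0H ⊎ v ≡ P → f v ≡ 0H)) ×
    (∀ w → ∃[ v ] Perp P v × f v ≡ w) ×
    (∀ v → Perp P v → Qb (f v) ≡ Q v)

module _ {n : ℕ} (O : OrthogonalSpread n) (N : H (suc n)) (β : SymForm n)
         (g : H (suc n) → H n) where
  open OrthogonalSpread O

  -- L ∈ Σ  iff  V(L) ∈ O/N (read through the coordinatisation g)
  InΣ : (F2^ n → F2^ n) → Set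
  InΣ L = ∃[ i ] SameSet (Img g (member i) N) (Graph β L)

  SplitBy : Fin size → Fin size → Set
  SplitBy iX iY =
    iX ≢ iY ×
    SameSet (Img g (member iX) N) (λ { (x , y) → y ≡ 0ᵥ }) ×
    SameSet (Img g (member iY) N) (λ { (x , y) → x ≡ 0ᵥ })

  -- W is a member of the shadow {V(C(a)+E_{a,a}) | a ∈ U}, where C(a) is the
  -- element of Σ with C(a)+E_{a,a} skew-symmetric
  ShadowMember : (H n → Set) → Set
  ShadowMember W =
    ∃[ a ] ∃[ L ] (InΣ L × Alternating β (λ x → L x +ᵥ E β a x) ×
                  SameSet W (Graph β (λ x → L x +ᵥ E β a x)))

IsShadowOfQuotient : ∀ {n} → OrthogonalSpread n → H (suc n) → H (suc n) → Set₁
IsShadowOfQuotient {n} O N P = let open OrthogonalSpread O in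
  ∃[ β ] ∃[ g ] (SymplecticCoord β N g ×
    ∃[ iX ] ∃[ iY ] (SplitBy O N β g iX iY ×
      ∃[ f ] (QuadraticCoord β P f ×
        -- every member of O/P = {⟨X ∩ P^⊥, P⟩/P | X ∈ O, P ∉ X} is a shadow member
        (∀ j → ¬ InSpan (member j) P → ShadowMember O N β g (Img f (member j) P)) ×
        (∀ W → ShadowMember O N β g W →
           ∃[ j ] (¬ InSpan (member j) P × SameSet W (Img f (member j) P))))))

module Submission where

open import Defs
open import Data.Bool using (Bool; true; false; _xor_; _∧_; if_then_else_)
open import Data.Bool.Properties
  using (¬-not; _≟_; xor-assoc; xor-comm; xor-same; xor-identityʳ; ∧-zeroʳ; ∧-identityʳ; ∧-comm; ∧-distribʳ-xor)
open import Data.Empty using (⊥-elim)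
open import Data.Fin using (Fin; zero; suc; punchIn)
import Data.Fin.Properties as Fin
open import Data.Nat using (ℕ; zero; suc; _+_; _≤_; z≤n; s≤s)
open import Data.Nat.Properties using (+-suc; +-identityʳ; m≤n⇒m≤1+n; 1+n≰n)
open import Data.Product using (Σ; ∃-syntax; _×_; _,_; proj₁; proj₂)
import Data.Product.Properties as Product
open import Data.Sum using (_⊎_; inj₁; inj₂) renaming (map to map-⊎)
open import Data.Vec using ([]; _∷_; _++_; head; tail; lookup; tabulate)
open import Data.Vec.Functional using (insertAt; removeAt) renaming (_∷_ to _∷ᶠ_)
open import Data.Vec.Functional.Properties using (insertAt-lookup; insertAt-punchIn; insertAt-removeAt)
open import Data.Vec.Properties
  using (zipWith-assoc; zipWith-comm; zipWith-identityˡ; map-id; zipWith-++; lookup∘tabulate; tabulate∘lookup;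
         tabulate-cong; lookup-replicate; lookup-zipWith; ++-injective; ≡-dec)
open import Function using (_∘_)
open import Relation.Binary.PropositionalEquality
open import Relation.Nullary using (¬_; Dec; yes; no)

-- Let X ∋ N + P and Y ∋ P be the members of O through these two singular points. A basis eX of
-- X ∩ N^⊥ and the dual basis f of Y ∩ N^⊥ (Bf (f k) (eX i) = δ i k) complete N and P to a basis of
-- V̄, and v ↦ (Bf v (f i), Bf v (eX i))ᵢ identifies N^⊥/N with U ⊕ U symplectically and P^⊥/P with
-- (U ⊕ U, b(x, y)) isometrically, carrying X and Y to U ⊕ 0 and 0 ⊕ U. A member Z ≠ Y of O becomes
-- the graph of a self-adjoint L in O/N and of an alternating M in O/P. Writing b(x, xL) = b(x, a),
-- singularity of Z gives M = L on a^⊥, and M + L has the diagonal of E_{a,a}; an additive map with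
-- both properties is E_{a,a}, so Z/P = V(L + E_{a,a}) is the shadow member of the spread element L.

-- Vector spaces over F₂

record F₂Space : Set₁ where
  infixl 6 _⊕_
  infixr 7 _⊙_
  field
    Carrier     : Set
    _⊕_         : Carrier → Carrier → Carrier
    𝟘           : Carrier
    _⊙_         : Bool → Carrier → Carrier
    ⊕-assoc     : ∀ x y z → (x ⊕ y) ⊕ z ≡ x ⊕ (y ⊕ z)
    ⊕-comm      : ∀ x y → x ⊕ y ≡ y ⊕ x
    ⊕-identityˡ : ∀ x → 𝟘 ⊕ x ≡ x
    ⊕-self      : ∀ x → x ⊕ x ≡ 𝟘
    ⊙-true      : ∀ x → true ⊙ x ≡ x
    ⊙-false     : ∀ x → false ⊙ x ≡ 𝟘

boolSpace : F₂Space
boolSpace = record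
  { Carrier = Bool ; _⊕_ = _xor_ ; 𝟘 = false ; _⊙_ = _∧_
  ; ⊕-assoc = xor-assoc ; ⊕-comm = xor-comm ; ⊕-identityˡ = λ _ → refl ; ⊕-self = xor-same
  ; ⊙-true = λ _ → refl ; ⊙-false = λ _ → refl }

+ᵥ-self : ∀ {m} (x : F2^ m) → x +ᵥ x ≡ 0ᵥ
+ᵥ-self []      = refl
+ᵥ-self (a ∷ x) = cong₂ _∷_ (xor-same a) (+ᵥ-self x)

·ᵥ-false : ∀ {m} (x : F2^ m) → false ·ᵥ x ≡ 0ᵥ
·ᵥ-false []      = refl
·ᵥ-false (a ∷ x) = cong (false ∷_) (·ᵥ-false x)

vecSpace : ℕ → F₂Space
vecSpace m = record
  { Carrier = F2^ m ; _⊕_ = _+ᵥ_ ; 𝟘 = 0ᵥ ; _⊙_ = _·ᵥ_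
  ; ⊕-assoc = zipWith-assoc xor-assoc ; ⊕-comm = zipWith-comm xor-comm
  ; ⊕-identityˡ = zipWith-identityˡ (λ _ → refl) ; ⊕-self = +ᵥ-self
  ; ⊙-true = map-id ; ⊙-false = ·ᵥ-false }

hSpace : ℕ → F₂Space
hSpace k = record
  { Carrier = H k ; _⊕_ = _+H_ ; 𝟘 = 0H ; _⊙_ = _·H_
  ; ⊕-assoc = λ { (a , b) (c , d) (e , f) → cong₂ _,_ (V.⊕-assoc a c e) (V.⊕-assoc b d f) }
  ; ⊕-comm = λ { (a , b) (c , d) → cong₂ _,_ (V.⊕-comm a c) (V.⊕-comm b d) }
  ; ⊕-identityˡ = λ { (a , b) → cong₂ _,_ (V.⊕-identityˡ a) (V.⊕-identityˡ b) }
  ; ⊕-self = λ { (a , b) → cong₂ _,_ (V.⊕-self a) (V.⊕-self b) }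
  ; ⊙-true = λ { (a , b) → cong₂ _,_ (V.⊙-true a) (V.⊙-true b) }
  ; ⊙-false = λ { (a , b) → cong₂ _,_ (V.⊙-false a) (V.⊙-false b) } }
  where module V = F₂Space (vecSpace k)

δ : ∀ {d} → Fin d → Fin d → Bool
δ zero    zero    = true
δ zero    (suc _) = false
δ (suc _) zero    = false
δ (suc i) (suc j) = δ i j

δ-sym : ∀ {d} (i j : Fin d) → δ i j ≡ δ j i
δ-sym zero    zero    = refl
δ-sym zero    (suc j) = refl
δ-sym (suc i) zero    = refl
δ-sym (suc i) (suc j) = δ-sym i j

module F₂SpaceTheory (V : F₂Space) where
  open F₂Space V public
  open ≡-Reasoning

  ⊕-identityʳ : ∀ x → x ⊕ 𝟘 ≡ x
  ⊕-identityʳ x = trans (⊕-comm x 𝟘) (⊕-identityˡ x)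

  ⊕-interchange : ∀ a b c d → (a ⊕ b) ⊕ (c ⊕ d) ≡ (a ⊕ c) ⊕ (b ⊕ d)
  ⊕-interchange a b c d = begin
    (a ⊕ b) ⊕ (c ⊕ d) ≡⟨ ⊕-assoc a b (c ⊕ d) ⟩
    a ⊕ (b ⊕ (c ⊕ d)) ≡⟨ cong (a ⊕_) (sym (⊕-assoc b c d)) ⟩
    a ⊕ ((b ⊕ c) ⊕ d) ≡⟨ cong (λ t → a ⊕ (t ⊕ d)) (⊕-comm b c) ⟩
    a ⊕ ((c ⊕ b) ⊕ d) ≡⟨ cong (a ⊕_) (⊕-assoc c b d) ⟩
    a ⊕ (c ⊕ (b ⊕ d)) ≡⟨ sym (⊕-assoc a c (b ⊕ d)) ⟩
    (a ⊕ c) ⊕ (b ⊕ d) ∎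

  ⊕-cancelʳ : ∀ x y → (x ⊕ y) ⊕ y ≡ x
  ⊕-cancelʳ x y = begin
    (x ⊕ y) ⊕ y ≡⟨ ⊕-assoc x y y ⟩
    x ⊕ (y ⊕ y) ≡⟨ cong (x ⊕_) (⊕-self y) ⟩
    x ⊕ 𝟘       ≡⟨ ⊕-identityʳ x ⟩
    x           ∎

  ⊕-cancel-middle : ∀ a b d → (a ⊕ b) ⊕ (b ⊕ d) ≡ a ⊕ d
  ⊕-cancel-middle a b d = begin
    (a ⊕ b) ⊕ (b ⊕ d)   ≡⟨ ⊕-assoc a b (b ⊕ d) ⟩
    a ⊕ (b ⊕ (b ⊕ d))   ≡⟨ cong (a ⊕_) (⊕-assoc b b d) ⟨
    a ⊕ ((b ⊕ b) ⊕ d)   ≡⟨ cong (λ t → a ⊕ (t ⊕ d)) (⊕-self b) ⟩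
    a ⊕ (𝟘 ⊕ d)         ≡⟨ cong (a ⊕_) (⊕-identityˡ d) ⟩
    a ⊕ d               ∎

  ⊕-move : ∀ {x y z} → x ⊕ y ≡ z → x ≡ y ⊕ z
  ⊕-move {x} {y} {z} eq = begin
    x           ≡⟨ sym (⊕-cancelʳ x y) ⟩
    (x ⊕ y) ⊕ y ≡⟨ cong (_⊕ y) eq ⟩
    z ⊕ y       ≡⟨ ⊕-comm z y ⟩
    y ⊕ z       ∎

  ⊕≡𝟘⇒≡ : ∀ {x y} → x ⊕ y ≡ 𝟘 → x ≡ y
  ⊕≡𝟘⇒≡ {y = y} eq = trans (⊕-move eq) (⊕-identityʳ y)

  ⊙-zeroʳ : ∀ c → c ⊙ 𝟘 ≡ 𝟘
  ⊙-zeroʳ false = ⊙-false 𝟘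
  ⊙-zeroʳ true  = ⊙-true 𝟘

  ⊙-distribˡ-⊕ : ∀ c x y → c ⊙ (x ⊕ y) ≡ c ⊙ x ⊕ c ⊙ y
  ⊙-distribˡ-⊕ false x y = trans (⊙-false _) (sym (trans (cong₂ _⊕_ (⊙-false x) (⊙-false y)) (⊕-identityˡ 𝟘)))
  ⊙-distribˡ-⊕ true  x y = trans (⊙-true _) (sym (cong₂ _⊕_ (⊙-true x) (⊙-true y)))

  ⊙-distribʳ-xor : ∀ c d x → (c xor d) ⊙ x ≡ c ⊙ x ⊕ d ⊙ x
  ⊙-distribʳ-xor false d x = sym (trans (cong (_⊕ d ⊙ x) (⊙-false x)) (⊕-identityˡ _))
  ⊙-distribʳ-xor true false x = sym (trans (cong (true ⊙ x ⊕_) (⊙-false x)) (⊕-identityʳ _))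
  ⊙-distribʳ-xor true true x = trans (⊙-false x) (sym (trans (cong₂ _⊕_ (⊙-true x) (⊙-true x)) (⊕-self x)))

  ∑ : ∀ {d} → (Fin d → Carrier) → Carrier
  ∑ {zero}  f = 𝟘
  ∑ {suc d} f = f zero ⊕ ∑ (f ∘ suc)

  ∑-cong : ∀ {d} {f g : Fin d → Carrier} → (∀ i → f i ≡ g i) → ∑ f ≡ ∑ g
  ∑-cong {zero}  p = refl
  ∑-cong {suc d} p = cong₂ _⊕_ (p zero) (∑-cong (p ∘ suc))

  ∑-zero : ∀ {d} {f : Fin d → Carrier} → (∀ i → f i ≡ 𝟘) → ∑ f ≡ 𝟘
  ∑-zero {zero}  p = refl
  ∑-zero {suc d} p = trans (cong₂ _⊕_ (p zero) (∑-zero (p ∘ suc))) (⊕-identityˡ 𝟘)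

  ∑-⊕ : ∀ {d} (f g : Fin d → Carrier) → ∑ (λ i → f i ⊕ g i) ≡ ∑ f ⊕ ∑ g
  ∑-⊕ {zero}  f g = sym (⊕-identityˡ 𝟘)
  ∑-⊕ {suc d} f g = trans (cong (f zero ⊕ g zero ⊕_) (∑-⊕ (f ∘ suc) (g ∘ suc))) (⊕-interchange _ _ _ _)

  ∑-δ : ∀ {d} (f : Fin d → Carrier) k → ∑ (λ i → δ i k ⊙ f i) ≡ f k
  ∑-δ {suc d} f zero =
    trans (cong₂ _⊕_ (⊙-true (f zero)) (∑-zero (λ i → ⊙-false (f (suc i))))) (⊕-identityʳ (f zero))
  ∑-δ {suc d} f (suc k) =
    trans (cong₂ _⊕_ (⊙-false (f zero)) (∑-δ (f ∘ suc) k)) (⊕-identityˡ (f (suc k)))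

  ∑-punchIn : ∀ {d} i (f : Fin (suc d) → Carrier) → ∑ f ≡ f i ⊕ ∑ (f ∘ punchIn i)
  ∑-punchIn zero f = refl
  ∑-punchIn {suc d} (suc i) f = begin
    f zero ⊕ ∑ (f ∘ suc)                          ≡⟨ cong (f zero ⊕_) (∑-punchIn i (f ∘ suc)) ⟩
    f zero ⊕ (f (suc i) ⊕ R)                      ≡⟨ sym (⊕-assoc _ _ R) ⟩
    (f zero ⊕ f (suc i)) ⊕ R                      ≡⟨ cong (_⊕ R) (⊕-comm _ _) ⟩
    (f (suc i) ⊕ f zero) ⊕ R                      ≡⟨ ⊕-assoc _ _ R ⟩
    f (suc i) ⊕ (f zero ⊕ R)                      ∎
    where R = ∑ (f ∘ suc ∘ punchIn i)

  lc : ∀ {d} → (Fin d → Bool) → (Fin d → Carrier) → Carrier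
  lc c e = ∑ (λ i → c i ⊙ e i)

  Span : ∀ {d} → (Fin d → Carrier) → Carrier → Set
  Span e v = ∃[ c ] lc c e ≡ v

  Independent : ∀ {d} → (Fin d → Carrier) → Set
  Independent e = ∀ c → lc c e ≡ 𝟘 → ∀ i → c i ≡ false

  lc-congˡ : ∀ {d} {c c′ : Fin d → Bool} (e : Fin d → Carrier) → (∀ i → c i ≡ c′ i) → lc c e ≡ lc c′ e
  lc-congˡ e p = ∑-cong (λ i → cong (_⊙ e i) (p i))

  lc-congʳ : ∀ {d} (c : Fin d → Bool) {e e′ : Fin d → Carrier} → (∀ i → e i ≡ e′ i) → lc c e ≡ lc c e′
  lc-congʳ c p = ∑-cong (λ i → cong (c i ⊙_) (p i))

  lc-⊕ : ∀ {d} (c c' : Fin d → Bool) (e : Fin d → Carrier) → lc (λ i → c i xor c' i) e ≡ lc c e ⊕ lc c' e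
  lc-⊕ c c' e = trans (∑-cong (λ i → ⊙-distribʳ-xor (c i) (c' i) (e i))) (∑-⊕ (λ i → c i ⊙ e i) (λ i → c' i ⊙ e i))

  lc-⊕ʳ : ∀ {d} (c : Fin d → Bool) (e e' : Fin d → Carrier) → lc c (λ i → e i ⊕ e' i) ≡ lc c e ⊕ lc c e'
  lc-⊕ʳ c e e' = trans (∑-cong (λ i → ⊙-distribˡ-⊕ (c i) (e i) (e' i))) (∑-⊕ (λ i → c i ⊙ e i) (λ i → c i ⊙ e' i))

  span-𝟘 : ∀ {d} (e : Fin d → Carrier) → Span e 𝟘
  span-𝟘 e = (λ _ → false) , ∑-zero (λ i → ⊙-false (e i))

  span-⊕ : ∀ {d} {e : Fin d → Carrier} {u v} → Span e u → Span e v → Span e (u ⊕ v)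
  span-⊕ {e = e} (c , p) (c' , p') = (λ i → c i xor c' i) , trans (lc-⊕ c c' e) (cong₂ _⊕_ p p')

  span-member : ∀ {d} (e : Fin d → Carrier) i → Span e (e i)
  span-member e i = (λ j → δ j i) , ∑-δ e i

  span-⊙ : ∀ {d} {e : Fin d → Carrier} b {u} → Span e u → Span e (b ⊙ u)
  span-⊙ {e = e} false p = subst (Span e) (sym (⊙-false _)) (span-𝟘 e)
  span-⊙ {e = e} true  p = subst (Span e) (sym (⊙-true _)) p

  span-lc : ∀ {d d'} (e : Fin d → Carrier) (f : Fin d' → Carrier) → (∀ i → Span e (f i)) → ∀ c → Span e (lc c f)
  span-lc {d' = zero}  e f fs c = span-𝟘 e
  span-lc {d' = suc _} e f fs c = span-⊕ {e = e} (span-⊙ {e = e} (c zero) (fs zero)) (span-lc e (f ∘ suc) (fs ∘ suc) (c ∘ suc))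

  span-cons : ∀ {d} {e : Fin (suc d) → Carrier} {v} b → Span (e ∘ suc) (b ⊙ e zero ⊕ v) → Span e v
  span-cons {e = e} {v} b (c , p) = (b ∷ᶠ c) , (begin
    b ⊙ e zero ⊕ lc c (e ∘ suc)         ≡⟨ cong (b ⊙ e zero ⊕_) p ⟩
    b ⊙ e zero ⊕ (b ⊙ e zero ⊕ v)       ≡⟨ sym (⊕-assoc _ _ v) ⟩
    (b ⊙ e zero ⊕ b ⊙ e zero) ⊕ v       ≡⟨ cong (_⊕ v) (⊕-self _) ⟩
    𝟘 ⊕ v                               ≡⟨ ⊕-identityˡ v ⟩
    v                                   ∎)

  span-uncons : ∀ {d} {e : Fin (suc d) → Carrier} {v} ((c , _) : Span e v) → Span (e ∘ suc) (c zero ⊙ e zero ⊕ v)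
  span-uncons (c , p) = c ∘ suc , ⊕-move (trans (⊕-comm _ _) p)

  module _ (_≟_ : (x y : Carrier) → Dec (x ≡ y)) where
    span? : ∀ {d} (e : Fin d → Carrier) v → Dec (Span e v)
    span? {zero} e v with 𝟘 ≟ v
    ... | yes p = yes ((λ ()) , p)
    ... | no ¬p = no λ (c , p) → ¬p p
    span? {suc d} e v with span? (e ∘ suc) (false ⊙ e zero ⊕ v) | span? (e ∘ suc) (true ⊙ e zero ⊕ v)
    ... | yes p | _     = yes (span-cons {e = e} false p)
    ... | no _  | yes q = yes (span-cons {e = e} true q)
    ... | no ¬p | no ¬q = no λ s → refute (proj₁ s zero) (span-uncons {e = e} s)
      where
      refute : ∀ b → ¬ Span (e ∘ suc) (b ⊙ e zero ⊕ v)
      refute false = ¬p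
      refute true  = ¬q

  ∷-independent : ∀ {d} {e : Fin d → Carrier} {t} → Independent e → ¬ Span e t → Independent (t ∷ᶠ e)
  ∷-independent {e = e} {t} ind t∉ c eq = λ { zero → head-false ; (suc i) → ind (c ∘ suc) tail-zero i }
    where
    tail-eq : lc (c ∘ suc) e ≡ c zero ⊙ t
    tail-eq = ⊕≡𝟘⇒≡ (trans (⊕-comm _ _) eq)
    head-cases : ∀ b → lc (c ∘ suc) e ≡ b ⊙ t → b ≡ false
    head-cases false _ = refl
    head-cases true  p = ⊥-elim (t∉ (c ∘ suc , trans p (⊙-true t)))
    head-false : c zero ≡ false
    head-false = head-cases (c zero) tail-eq
    tail-zero : lc (c ∘ suc) e ≡ 𝟘
    tail-zero = trans tail-eq (trans (cong (_⊙ t) head-false) (⊙-false t))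

module 𝔹 = F₂SpaceTheory boolSpace

lc-δ : ∀ {d} (c : Fin d → Bool) k → 𝔹.lc c (λ i → δ i k) ≡ c k
lc-δ c k = trans (𝔹.∑-cong (λ i → ∧-comm (c i) (δ i k))) (𝔹.∑-δ c k)

module AdditiveMap (V W : F₂Space) (h : F₂Space.Carrier V → F₂Space.Carrier W) where
  private
    module V = F₂SpaceTheory V
    module W = F₂SpaceTheory W

  IsAdditive : Set
  IsAdditive = ∀ x y → h (x V.⊕ y) ≡ h x W.⊕ h y

  module _ (h-⊕ : IsAdditive) where
    h-𝟘 : h V.𝟘 ≡ W.𝟘
    h-𝟘 = begin
      h V.𝟘                   ≡⟨ cong h (sym (V.⊕-self V.𝟘)) ⟩
      h (V.𝟘 V.⊕ V.𝟘)         ≡⟨ h-⊕ V.𝟘 V.𝟘 ⟩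
      h V.𝟘 W.⊕ h V.𝟘         ≡⟨ W.⊕-self (h V.𝟘) ⟩
      W.𝟘                     ∎
      where open ≡-Reasoning

    h-⊙ : ∀ c x → h (c V.⊙ x) ≡ c W.⊙ h x
    h-⊙ false x = trans (cong h (V.⊙-false x)) (trans h-𝟘 (sym (W.⊙-false (h x))))
    h-⊙ true  x = trans (cong h (V.⊙-true x)) (sym (W.⊙-true (h x)))

    h-lc : ∀ {d} (c : Fin d → Bool) (e : Fin d → V.Carrier) → h (V.lc c e) ≡ W.lc c (h ∘ e)
    h-lc {zero}  c e = h-𝟘
    h-lc {suc d} c e = trans (h-⊕ _ _) (cong₂ W._⊕_ (h-⊙ (c zero) (e zero)) (h-lc (c ∘ suc) (e ∘ suc)))

    h-independent : (∀ x → h x ≡ W.𝟘 → x ≡ V.𝟘) →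
                    ∀ {d} {e : Fin d → V.Carrier} → V.Independent e → W.Independent (h ∘ e)
    h-independent ker {e = e} ind c eq = ind c (ker _ (trans (h-lc c e) eq))

    h-span-reflect : (∀ x → h x ≡ W.𝟘 → x ≡ V.𝟘) →
                     ∀ {d} (e : Fin d → V.Carrier) {v} → W.Span (h ∘ e) (h v) → V.Span e v
    h-span-reflect ker e {v} (c , p) = c , V.⊕≡𝟘⇒≡ (ker _ (begin
      h (V.lc c e V.⊕ v)      ≡⟨ h-⊕ (V.lc c e) v ⟩
      h (V.lc c e) W.⊕ h v    ≡⟨ cong (W._⊕ h v) (trans (h-lc c e) p) ⟩
      h v W.⊕ h v             ≡⟨ W.⊕-self (h v) ⟩
      W.𝟘                     ∎))
      where open ≡-Reasoning

    h-span-𝟘 : ∀ {d} (e : Fin d → V.Carrier) {v} → (∀ i → h (e i) ≡ W.𝟘) → V.Span e v → h v ≡ W.𝟘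
    h-span-𝟘 e he (c , refl) = trans (h-lc c e) (W.∑-zero (λ i → trans (cong (c i W.⊙_) (he i)) (W.⊙-zeroʳ (c i))))

module Pivoting (V : F₂Space) where
  open F₂SpaceTheory V
  open AdditiveMap V boolSpace using (IsAdditive; h-lc; h-span-𝟘)
  open ≡-Reasoning

  lc-⊙ : ∀ {d} (c s : Fin d → Bool) v → lc c (λ j → s j ⊙ v) ≡ 𝔹.lc c s ⊙ v
  lc-⊙ c s v = sym (AdditiveMap.h-lc boolSpace V (_⊙ v) (λ a b → ⊙-distribʳ-xor a b v) c s)

  pivot : ∀ {d} → (Fin (suc d) → Carrier) → Fin (suc d) → (Fin d → Bool) → Fin d → Carrier
  pivot z i s j = z (punchIn i j) ⊕ s j ⊙ z i

  lc-pivot : ∀ {d} (z : Fin (suc d) → Carrier) i s (c : Fin d → Bool) →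
             lc c (pivot z i s) ≡ lc (insertAt c i (𝔹.lc c s)) z
  lc-pivot z i s c = begin
    lc c (pivot z i s)                                  ≡⟨ lc-⊕ʳ c (z ∘ punchIn i) (λ j → s j ⊙ z i) ⟩
    lc c (z ∘ punchIn i) ⊕ lc c (λ j → s j ⊙ z i)       ≡⟨ cong (lc c (z ∘ punchIn i) ⊕_) (lc-⊙ c s (z i)) ⟩
    lc c (z ∘ punchIn i) ⊕ σ ⊙ z i                      ≡⟨ ⊕-comm _ _ ⟩
    σ ⊙ z i ⊕ lc c (z ∘ punchIn i)                      ≡⟨ sym (cong₂ _⊕_ (cong (_⊙ z i) (insertAt-lookup c i σ))
                                                              (lc-congˡ (z ∘ punchIn i) (insertAt-punchIn c i σ))) ⟩
    c' i ⊙ z i ⊕ lc (c' ∘ punchIn i) (z ∘ punchIn i)    ≡⟨ sym (∑-punchIn i (λ j → c' j ⊙ z j)) ⟩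
    lc c' z                                             ∎
    where
    σ = 𝔹.lc c s
    c' = insertAt c i σ

  module Section {d} (z : Fin (suc d) → Carrier) (i : Fin (suc d)) (φ : Carrier → Bool)
                 (φ-⊕ : IsAdditive φ) (φzi : φ (z i) ≡ true) where
    coeffs : Fin d → Bool
    coeffs j = φ (z (punchIn i j))

    section : Fin d → Carrier
    section = pivot z i coeffs

    section-independent : Independent z → Independent section
    section-independent ind c eq j =
      trans (sym (insertAt-punchIn c i σ j)) (ind (insertAt c i σ) (trans (sym (lc-pivot z i coeffs c)) eq) (punchIn i j))
      where σ = 𝔹.lc c coeffs

    section-span : ∀ j → Span z (section j)
    section-span j = span-⊕ {e = z} (span-member z (punchIn i j)) (span-⊙ {e = z} (coeffs j) (span-member z i))

    φ-corrected : ∀ {p} → φ p ≡ true → ∀ x → φ (x ⊕ φ x ⊙ p) ≡ false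
    φ-corrected {p} φp x = begin
      φ (x ⊕ φ x ⊙ p)         ≡⟨ φ-⊕ x (φ x ⊙ p) ⟩
      φ x xor φ (φ x ⊙ p)     ≡⟨ cong (φ x xor_) (AdditiveMap.h-⊙ V boolSpace φ φ-⊕ (φ x) p) ⟩
      φ x xor (φ x ∧ φ p)     ≡⟨ cong (λ t → φ x xor (φ x ∧ t)) φp ⟩
      φ x xor (φ x ∧ true)    ≡⟨ cong (φ x xor_) (∧-identityʳ (φ x)) ⟩
      φ x xor φ x             ≡⟨ xor-same (φ x) ⟩
      false                   ∎

    section-kernel : ∀ j → φ (section j) ≡ false
    section-kernel j = φ-corrected φzi (z (punchIn i j))

    section-spans-kernel : ∀ {v} → Span z v → φ v ≡ false → Span section v
    section-spans-kernel {v} (c , refl) φv = c ∘ punchIn i , (begin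
      lc (c ∘ punchIn i) section                          ≡⟨ lc-pivot z i coeffs (c ∘ punchIn i) ⟩
      lc (insertAt (removeAt c i) i σ) z                  ≡⟨ cong (λ t → lc (insertAt (removeAt c i) i t) z) σ≡ci ⟩
      lc (insertAt (removeAt c i) i (c i)) z              ≡⟨ lc-congˡ z (insertAt-removeAt c i) ⟩
      lc c z                                              ∎)
      where
      σ = 𝔹.lc (c ∘ punchIn i) coeffs
      φ-expansion : φ (lc c z) ≡ c i xor σ
      φ-expansion = begin
        φ (lc c z)                      ≡⟨ h-lc φ φ-⊕ c z ⟩
        𝔹.lc c (φ ∘ z)                  ≡⟨ 𝔹.∑-punchIn i (λ j → c j ∧ φ (z j)) ⟩
        (c i ∧ φ (z i)) xor σ           ≡⟨ cong (λ t → (c i ∧ t) xor σ) φzi ⟩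
        (c i ∧ true) xor σ              ≡⟨ cong (_xor σ) (∧-identityʳ (c i)) ⟩
        c i xor σ                       ∎
      σ≡ci : σ ≡ c i
      σ≡ci = sym (𝔹.⊕≡𝟘⇒≡ (trans (sym φ-expansion) φv))

    -- u ⊕ φ u ⊙ p lies in the kernel of φ, hence in the span of the section.
    vanishes-on-span : ∀ p → Span z p → φ p ≡ true → (ψ : Carrier → Bool) → IsAdditive ψ →
                       (∀ j → ψ (section j) ≡ false) → ψ p ≡ false → ∀ {u} → Span z u → ψ u ≡ false
    vanishes-on-span p p∈ φp ψ ψ-⊕ ψsec ψp {u} u∈ = begin
      ψ u                        ≡⟨ cong ψ (sym (⊕-cancelʳ u (φ u ⊙ p))) ⟩
      ψ (u′ ⊕ φ u ⊙ p)           ≡⟨ ψ-⊕ u′ (φ u ⊙ p) ⟩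
      ψ u′ xor ψ (φ u ⊙ p)       ≡⟨ cong₂ _xor_ ψu′ (trans (AdditiveMap.h-⊙ V boolSpace ψ ψ-⊕ (φ u) p) (cong (φ u ∧_) ψp)) ⟩
      false xor (φ u ∧ false)    ≡⟨ ∧-zeroʳ (φ u) ⟩
      false                      ∎
      where
      u′ = u ⊕ φ u ⊙ p
      ψu′ : ψ u′ ≡ false
      ψu′ = AdditiveMap.h-span-𝟘 V boolSpace ψ ψ-⊕ section ψsec
              (section-spans-kernel (span-⊕ {e = z} u∈ (span-⊙ {e = z} (φ u) p∈)) (φ-corrected φp u))

module Vec₂ {m : ℕ} = F₂SpaceTheory (vecSpace m)

module H₂ {k : ℕ} = F₂SpaceTheory (hSpace k)

-- Coordinates in F₂^m

find-true : ∀ {d} (f : Fin d → Bool) → (∃[ i ] f i ≡ true) ⊎ (∀ i → f i ≡ false)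
find-true f with Fin.any? (λ i → f i ≟ true)
... | yes p = inj₁ p
... | no ¬p = inj₂ (λ i → ¬-not (λ fi → ¬p (i , fi)))

dot-comm : ∀ {m} (x y : F2^ m) → dot x y ≡ dot y x
dot-comm []      []      = refl
dot-comm (a ∷ x) (b ∷ y) = cong₂ _xor_ (∧-comm a b) (dot-comm x y)

dot-+ˡ : ∀ {m} (z : F2^ m) → AdditiveMap.IsAdditive (vecSpace m) boolSpace (λ x → dot x z)
dot-+ˡ []      []      []      = refl
dot-+ˡ (c ∷ z) (a ∷ x) (b ∷ y) =
  trans (cong₂ _xor_ (∧-distribʳ-xor c a b) (dot-+ˡ z x y)) (𝔹.⊕-interchange (a ∧ c) (b ∧ c) (dot x z) (dot y z))

dot-+ʳ : ∀ {m} (x : F2^ m) → AdditiveMap.IsAdditive (vecSpace m) boolSpace (dot x)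
dot-+ʳ x y z = trans (dot-comm x (y +ᵥ z)) (trans (dot-+ˡ x y z) (cong₂ _xor_ (dot-comm y x) (dot-comm z x)))

dot-zeroˡ : ∀ {m} (y : F2^ m) → dot 0ᵥ y ≡ false
dot-zeroˡ {m} y = AdditiveMap.h-𝟘 (vecSpace m) boolSpace (λ x → dot x y) (dot-+ˡ y)

vec-ext : ∀ {m} {x y : F2^ m} → (∀ k → lookup x k ≡ lookup y k) → x ≡ y
vec-ext {x = x} {y} p = trans (sym (tabulate∘lookup x)) (trans (tabulate-cong p) (tabulate∘lookup y))

lookup-+ : ∀ {m} (k : Fin m) → AdditiveMap.IsAdditive (vecSpace m) boolSpace (λ x → lookup x k)
lookup-+ k = lookup-zipWith _xor_ k

tabulate-xor : ∀ {m} (f g : Fin m → Bool) → tabulate (λ i → f i xor g i) ≡ tabulate f +ᵥ tabulate g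
tabulate-xor {zero}  f g = refl
tabulate-xor {suc m} f g = cong ((f zero xor g zero) ∷_) (tabulate-xor (f ∘ suc) (g ∘ suc))

tabulate-false : ∀ {m} {f : Fin m → Bool} → (∀ i → f i ≡ false) → tabulate f ≡ 0ᵥ
tabulate-false {zero}  p = refl
tabulate-false {suc m} p = cong₂ _∷_ (p zero) (tabulate-false (p ∘ suc))

tabulate≡0ᵥ : ∀ {m} (f : Fin m → Bool) → tabulate f ≡ 0ᵥ → ∀ i → f i ≡ false
tabulate≡0ᵥ f eq i = trans (sym (lookup∘tabulate f i)) (trans (cong (λ x → lookup x i) eq) (lookup-replicate i false))

unit : ∀ {m} → Fin m → F2^ m
unit k = tabulate (λ i → δ i k)

lookup-unit : ∀ {m} (k i : Fin m) → lookup (unit k) i ≡ δ i k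
lookup-unit k = lookup∘tabulate (λ i → δ i k)

dot-∑ : ∀ {m} (x y : F2^ m) → dot x y ≡ 𝔹.lc (lookup x) (lookup y)
dot-∑ []      []      = refl
dot-∑ (a ∷ x) (b ∷ y) = cong ((a ∧ b) xor_) (dot-∑ x y)

dot-unit : ∀ {m} (x : F2^ m) k → dot x (unit k) ≡ lookup x k
dot-unit x k = begin
  dot x (unit k)                       ≡⟨ dot-∑ x (unit k) ⟩
  𝔹.lc (lookup x) (lookup (unit k))    ≡⟨ 𝔹.lc-congʳ (lookup x) (lookup-unit k) ⟩
  𝔹.lc (lookup x) (λ i → δ i k)        ≡⟨ lc-δ (lookup x) k ⟩
  lookup x k                           ∎
  where open ≡-Reasoning

dot-ext : ∀ {m} {c a : F2^ m} → (∀ x → dot x c ≡ dot x a) → c ≡ a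
dot-ext {c = c} {a} p = vec-ext λ k → begin
  lookup c k         ≡⟨ dot-unit c k ⟨
  dot c (unit k)     ≡⟨ dot-comm c (unit k) ⟩
  dot (unit k) c     ≡⟨ p (unit k) ⟩
  dot (unit k) a     ≡⟨ dot-comm (unit k) a ⟩
  dot a (unit k)     ≡⟨ dot-unit a k ⟩
  lookup a k         ∎
  where open ≡-Reasoning

functional-representation : ∀ {m} (ℓ : F2^ m → Bool) → AdditiveMap.IsAdditive (vecSpace m) boolSpace ℓ →
                            ∀ x → ℓ x ≡ dot x (tabulate (ℓ ∘ unit))
functional-representation {m} ℓ ℓ-+ x = begin
  ℓ x                                   ≡⟨ cong ℓ expansion ⟩
  ℓ (Vec₂.lc (lookup x) unit)           ≡⟨ AdditiveMap.h-lc (vecSpace m) boolSpace ℓ ℓ-+ (lookup x) unit ⟩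
  𝔹.lc (lookup x) (ℓ ∘ unit)            ≡⟨ 𝔹.lc-congʳ (lookup x) (lookup∘tabulate (ℓ ∘ unit)) ⟨
  𝔹.lc (lookup x) (lookup (tabulate (ℓ ∘ unit)))  ≡⟨ dot-∑ x _ ⟨
  dot x (tabulate (ℓ ∘ unit))           ∎
  where
  open ≡-Reasoning
  expansion : x ≡ Vec₂.lc (lookup x) unit
  expansion = vec-ext λ k → sym (begin
    lookup (Vec₂.lc (lookup x) unit) k              ≡⟨ AdditiveMap.h-lc (vecSpace m) boolSpace (λ y → lookup y k) (lookup-+ k) (lookup x) unit ⟩
    𝔹.lc (lookup x) (λ i → lookup (unit i) k)       ≡⟨ 𝔹.lc-congʳ (lookup x) (λ i → trans (lookup-unit i k) (δ-sym k i)) ⟩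
    𝔹.lc (lookup x) (λ i → δ i k)                   ≡⟨ lc-δ (lookup x) k ⟩
    lookup x k                                      ∎)

rank-one-characterisation : ∀ {m} (D : F2^ m → F2^ m) a → AdditiveMap.IsAdditive (vecSpace m) (vecSpace m) D →
  (∀ x → dot x a ≡ false → D x ≡ 0ᵥ) → (∀ x → dot x (D x) ≡ dot x a) → ∀ x → D x ≡ (if dot x a then a else 0ᵥ)
rank-one-characterisation D a D-+ kernel diagonal x with dot x a in xa
... | false = kernel x xa
... | true  = dot-ext dot-agrees
  where
  constant : ∀ x′ → dot x′ a ≡ true → D x′ ≡ D x
  constant x′ x′a =
    Vec₂.⊕≡𝟘⇒≡ (trans (sym (D-+ x′ x)) (kernel (x′ +ᵥ x) (trans (dot-+ˡ a x′ x) (cong₂ _xor_ x′a xa))))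
  on-coset : ∀ x′ → dot x′ a ≡ true → dot x′ (D x) ≡ true
  on-coset x′ x′a = trans (cong (dot x′) (sym (constant x′ x′a))) (trans (diagonal x′) x′a)
  dot-agrees : ∀ x′ → dot x′ (D x) ≡ dot x′ a
  dot-agrees x′ with dot x′ a in x′a
  ... | true  = on-coset x′ x′a
  ... | false = 𝔹.⊕-move (begin
    dot x′ (D x) xor true                    ≡⟨ cong (dot x′ (D x) xor_) (on-coset x xa) ⟨
    dot x′ (D x) xor dot x (D x)             ≡⟨ dot-+ˡ (D x) x′ x ⟨
    dot (x′ +ᵥ x) (D x)                      ≡⟨ on-coset (x′ +ᵥ x) (trans (dot-+ˡ a x′ x) (cong₂ _xor_ x′a xa)) ⟩
    true                                     ∎)
    where open ≡-Reasoning

dotForm : ∀ n → SymForm n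
dotForm n = record { b = dot ; additive = λ x x′ y → dot-+ˡ y x x′ ; symm = dot-comm ; nondeg = nondeg }
  where
  nondeg : ∀ x → x ≢ 0ᵥ → ∃[ y ] dot x y ≡ true
  nondeg x x≢0 with find-true (lookup x)
  ... | inj₁ (k , xk) = unit k , trans (dot-unit x k) xk
  ... | inj₂ x≡0      = ⊥-elim (x≢0 (vec-ext (λ k → trans (x≡0 k) (sym (lookup-replicate k false)))))

E-diagonal : ∀ {n} (a x : F2^ n) → dot x (E (dotForm n) a x) ≡ dot x a
E-diagonal {n} a x with dot x a in xa
... | true  = xa
... | false = trans (dot-comm x 0ᵥ) (dot-zeroˡ {n} x)

-- Counting dimensions by elimination

head-+ : ∀ {m} → AdditiveMap.IsAdditive (vecSpace (suc m)) boolSpace head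
head-+ (a ∷ x) (b ∷ y) = refl

tail-+ : ∀ {m} → AdditiveMap.IsAdditive (vecSpace (suc m)) (vecSpace m) tail
tail-+ (a ∷ x) (b ∷ y) = refl

head-tail-zero : ∀ {m} (x : F2^ (suc m)) → head x ≡ false → tail x ≡ 0ᵥ → x ≡ 0ᵥ
head-tail-zero (a ∷ x) refl refl = refl

dot-tailʳ : ∀ {m} (x y : F2^ (suc m)) → head y ≡ false → dot (tail x) (tail y) ≡ dot x y
dot-tailʳ (a ∷ x) (.false ∷ y) refl = cong (_xor dot x y) (sym (∧-zeroʳ a))

dot-head : ∀ {m} (x p : F2^ (suc m)) → tail x ≡ 0ᵥ → head p ≡ true → dot x p ≡ head x
dot-head (a ∷ x) (.true ∷ p) refl refl = trans (cong₂ _xor_ (∧-identityʳ a) (dot-zeroˡ p)) (xor-identityʳ a)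

module _ {d m : ℕ} where
  open Vec₂ {suc m}
  private
    module Head = AdditiveMap (vecSpace (suc m)) boolSpace head
    module Tail = AdditiveMap (vecSpace (suc m)) (vecSpace m) tail

  tail-independent : (e : Fin d → F2^ (suc m)) → (∀ j → head (e j) ≡ false) → Independent e →
                     Vec₂.Independent (tail ∘ e)
  tail-independent e heads ind c eq =
    ind c (head-tail-zero (lc c e) (Head.h-span-𝟘 head-+ e heads (c , refl)) (trans (Tail.h-lc tail-+ c e) eq))

  -- A combination with zero tail is (head x) times the first unit vector, and its pairing with p is head x.
  tail-independent-⊥ : (e : Fin d → F2^ (suc m)) (p : F2^ (suc m)) → head p ≡ true → (∀ j → dot (e j) p ≡ false) →
                       Independent e → Vec₂.Independent (tail ∘ e)
  tail-independent-⊥ e p hp orth ind c eq = ind c (head-tail-zero x head-zero tail-zero)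
    where
    x = lc c e
    tail-zero : tail x ≡ 0ᵥ
    tail-zero = trans (Tail.h-lc tail-+ c e) eq
    head-zero : head x ≡ false
    head-zero = trans (sym (dot-head x p tail-zero hp))
                      (AdditiveMap.h-span-𝟘 (vecSpace (suc m)) boolSpace (λ y → dot y p) (dot-+ˡ p) e orth (c , refl))

vec-zero-dim : (x : F2^ 0) → x ≡ 0ᵥ
vec-zero-dim [] = refl

no-independent-zero-dim : ∀ {k} (a : Fin (suc k) → F2^ 0) → ¬ Vec₂.Independent a
no-independent-zero-dim a ind with ind (λ _ → true) (vec-zero-dim _) zero
... | ()

-- Gaussian elimination on the first coordinate.
independent-⊥-bound : ∀ m {k r} (a : Fin k → F2^ m) (v : Fin r → F2^ m) →
                      Vec₂.Independent a → Vec₂.Independent v → (∀ i j → dot (v j) (a i) ≡ false) → r + k ≤ m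
independent-⊥-bound zero {zero}  {zero}  a v ia iv orth = z≤n
independent-⊥-bound zero {suc k}         a v ia iv orth = ⊥-elim (no-independent-zero-dim a ia)
independent-⊥-bound zero {zero}  {suc r} a v ia iv orth = ⊥-elim (no-independent-zero-dim v iv)
independent-⊥-bound (suc m) a v ia iv orth with find-true (head ∘ a) | find-true (head ∘ v)
independent-⊥-bound (suc m) {suc k} {r} a v ia iv orth | inj₁ (i , hi) | _ =
  subst (_≤ suc m) (sym (+-suc r k))
    (s≤s (independent-⊥-bound m (tail ∘ section) (tail ∘ v)
      (tail-independent section section-kernel (section-independent ia))
      (tail-independent-⊥ v (a i) hi (λ j → orth i j) iv)
      orth′))
  where
  open Pivoting (vecSpace (suc m))
  open Section a i head head-+ hi
  orth′ : ∀ i′ j → dot (tail (v j)) (tail (section i′)) ≡ false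
  orth′ i′ j = trans (dot-tailʳ (v j) (section i′) (section-kernel i′))
                     (AdditiveMap.h-span-𝟘 (vecSpace (suc m)) boolSpace (dot (v j)) (dot-+ʳ (v j)) a
                        (λ i → orth i j) (section-span i′))
independent-⊥-bound (suc m) {k} {suc r} a v ia iv orth | inj₂ ha | inj₁ (j , hj) =
  s≤s (independent-⊥-bound m (tail ∘ a) (tail ∘ section)
    (tail-independent a ha ia)
    (tail-independent section section-kernel (section-independent iv))
    orth′)
  where
  open Pivoting (vecSpace (suc m))
  open Section v j head head-+ hj
  orth′ : ∀ i j′ → dot (tail (section j′)) (tail (a i)) ≡ false
  orth′ i j′ = trans (dot-tailʳ (section j′) (a i) (ha i))
                     (AdditiveMap.h-span-𝟘 (vecSpace (suc m)) boolSpace (λ x → dot x (a i)) (dot-+ˡ (a i)) v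
                        (orth i) (section-span j′))
independent-⊥-bound (suc m) a v ia iv orth | inj₂ ha | inj₂ hv =
  m≤n⇒m≤1+n (independent-⊥-bound m (tail ∘ a) (tail ∘ v) (tail-independent a ha ia) (tail-independent v hv iv)
    (λ i j → trans (dot-tailʳ (v j) (a i) (ha i)) (orth i j)))

independent-spans : ∀ {n} (ξ : Fin n → F2^ n) → Vec₂.Independent ξ → ∀ t → Vec₂.Span ξ t
independent-spans {n} ξ ind t with Vec₂.span? (≡-dec _≟_) ξ t
... | yes t∈ = t∈
... | no  t∉ = ⊥-elim (1+n≰n (subst (_≤ n) (+-identityʳ (suc n))
                 (independent-⊥-bound n {0} (λ ()) (t ∷ᶠ ξ) (λ _ _ ()) (Vec₂.∷-independent ind t∉) (λ ()))))

-- The quadratic space V⁺(2k,2)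

Bf-+ˡ : ∀ {k} (z : H k) → AdditiveMap.IsAdditive (hSpace k) boolSpace (λ x → Bf x z)
Bf-+ˡ (e , f) (a , b) (c , d) =
  trans (cong₂ _xor_ (dot-+ˡ f a c) (dot-+ˡ e b d)) (𝔹.⊕-interchange (dot a f) (dot c f) (dot b e) (dot d e))

Bf-comm : ∀ {k} (x y : H k) → Bf x y ≡ Bf y x
Bf-comm (a , b) (c , d) = trans (xor-comm (dot a d) (dot b c)) (cong₂ _xor_ (dot-comm b c) (dot-comm a d))

Bf-+ʳ : ∀ {k} (x : H k) → AdditiveMap.IsAdditive (hSpace k) boolSpace (Bf x)
Bf-+ʳ x y z = trans (Bf-comm x (y +H z)) (trans (Bf-+ˡ x y z) (cong₂ _xor_ (Bf-comm y x) (Bf-comm z x)))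

Bf-self : ∀ {k} (x : H k) → Bf x x ≡ false
Bf-self (a , b) = trans (cong (dot a b xor_) (dot-comm b a)) (xor-same (dot a b))

Bf-·ˡ : ∀ {k} c (u w : H k) → Bf (c ·H u) w ≡ c ∧ Bf u w
Bf-·ˡ {k} c u w = AdditiveMap.h-⊙ (hSpace k) boolSpace (λ x → Bf x w) (Bf-+ˡ w) c u

Bf-0ˡ : ∀ {k} (w : H k) → Bf 0H w ≡ false
Bf-0ˡ {k} w = AdditiveMap.h-𝟘 (hSpace k) boolSpace (λ u → Bf u w) (Bf-+ˡ w)

⊥-+ˡ : ∀ {k} (u u′ v : H k) → Bf u v ≡ false → Bf u′ v ≡ false → Bf (u +H u′) v ≡ false
⊥-+ˡ u u′ v p q = trans (Bf-+ˡ v u u′) (cong₂ _xor_ p q)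

⊥-lc : ∀ {d k} (w : H k) (b : Fin d → H k) → (∀ j → Perp w (b j)) → ∀ c → Perp w (H₂.lc c b)
⊥-lc {k = k} w b b⊥ c = AdditiveMap.h-span-𝟘 (hSpace k) boolSpace (λ u → Bf u w) (Bf-+ˡ w) b b⊥ (c , refl)

Q-+ : ∀ {k} (x y : H k) → Q (x +H y) ≡ (Q x xor Q y) xor Bf x y
Q-+ (a , b) (c , d) = begin
  dot (a +ᵥ c) (b +ᵥ d)                             ≡⟨ dot-+ˡ (b +ᵥ d) a c ⟩
  dot a (b +ᵥ d) xor dot c (b +ᵥ d)                 ≡⟨ cong₂ _xor_ (dot-+ʳ a b d) (dot-+ʳ c b d) ⟩
  (dot a b xor dot a d) xor (dot c b xor dot c d)   ≡⟨ 𝔹.⊕-interchange (dot a b) (dot a d) (dot c b) (dot c d) ⟩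
  (dot a b xor dot c b) xor (dot a d xor dot c d)   ≡⟨ cong₂ (λ s t → (dot a b xor s) xor t) (dot-comm c b) (xor-comm (dot a d) (dot c d)) ⟩
  (dot a b xor dot b c) xor (dot c d xor dot a d)   ≡⟨ 𝔹.⊕-interchange (dot a b) (dot b c) (dot c d) (dot a d) ⟩
  (dot a b xor dot c d) xor (dot b c xor dot a d)   ≡⟨ cong ((dot a b xor dot c d) xor_) (xor-comm (dot b c) (dot a d)) ⟩
  (dot a b xor dot c d) xor (dot a d xor dot b c)   ∎
  where open ≡-Reasoning

Q-· : ∀ {k} c (x : H k) → Q (c ·H x) ≡ c ∧ Q x
Q-· {k} false x = trans (cong Q (H₂.⊙-false x)) (dot-zeroˡ {k} 0ᵥ)
Q-· true  x = cong Q (H₂.⊙-true x)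

Q-+· : ∀ {k} (w z : H k) c → Q (w +H (c ·H z)) ≡ (Q w xor (c ∧ Q z)) xor (c ∧ Bf w z)
Q-+· w z c = trans (Q-+ w (c ·H z)) (cong₂ (λ s t → (Q w xor s) xor t) (Q-· c z)
               (trans (Bf-comm w (c ·H z)) (trans (Bf-·ˡ c z w) (cong (c ∧_) (Bf-comm z w)))))

·H-cases : ∀ {k} b (x : H k) → b ·H x ≡ 0H ⊎ b ·H x ≡ x
·H-cases false x = inj₁ (H₂.⊙-false x)
·H-cases true  x = inj₂ (H₂.⊙-true x)

_≟H_ : ∀ {k} (x y : H k) → Dec (x ≡ y)
_≟H_ = Product.≡-dec (≡-dec _≟_) (≡-dec _≟_)

-- Bf x y = dot (flatten x) (flatten′ y) turns a question about H k into one about F2^ (k + k).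
flatten flatten′ : ∀ {k} → H k → F2^ (k + k)
flatten  (u , w) = u ++ w
flatten′ (u , w) = w ++ u

0ᵥ-++ : ∀ {a b} → 0ᵥ {a} ++ 0ᵥ {b} ≡ 0ᵥ
0ᵥ-++ {zero}  = refl
0ᵥ-++ {suc a} = cong (false ∷_) (0ᵥ-++ {a})

++-+ᵥ : ∀ {a b} (x x′ : F2^ a) (y y′ : F2^ b) → (x ++ y) +ᵥ (x′ ++ y′) ≡ (x +ᵥ x′) ++ (y +ᵥ y′)
++-+ᵥ x x′ y y′ = zipWith-++ _xor_ x y x′ y′

dot-++ : ∀ {a b} (x x′ : F2^ a) (y y′ : F2^ b) → dot (x ++ y) (x′ ++ y′) ≡ dot x x′ xor dot y y′
dot-++ []      []        y y′ = refl
dot-++ (h ∷ x) (h′ ∷ x′) y y′ = trans (cong ((h ∧ h′) xor_) (dot-++ x x′ y y′)) (sym (xor-assoc (h ∧ h′) _ _))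

Bf-flatten : ∀ {k} (x y : H k) → Bf x y ≡ dot (flatten x) (flatten′ y)
Bf-flatten (u , w) (u′ , w′) = sym (dot-++ u w′ w u′)

flatten-+ : ∀ {k} → AdditiveMap.IsAdditive (hSpace k) (vecSpace (k + k)) flatten
flatten-+ (u , w) (u′ , w′) = sym (++-+ᵥ u u′ w w′)

flatten′-+ : ∀ {k} → AdditiveMap.IsAdditive (hSpace k) (vecSpace (k + k)) flatten′
flatten′-+ (u , w) (u′ , w′) = sym (++-+ᵥ w w′ u u′)

flatten-ker : ∀ {k} (x : H k) → flatten x ≡ 0ᵥ → x ≡ 0H
flatten-ker {k} (u , w) eq with ++-injective u 0ᵥ (trans eq (sym (0ᵥ-++ {k} {k})))
... | u≡0 , w≡0 = cong₂ _,_ u≡0 w≡0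

flatten′-ker : ∀ {k} (x : H k) → flatten′ x ≡ 0ᵥ → x ≡ 0H
flatten′-ker {k} (u , w) eq with ++-injective w 0ᵥ (trans eq (sym (0ᵥ-++ {k} {k})))
... | w≡0 , u≡0 = cong₂ _,_ u≡0 w≡0

isotropic-basis-⊥-span : ∀ {k} (z : Fin k → H k) → H₂.Independent z → (∀ i j → Bf (z i) (z j) ≡ false) →
                         ∀ v → (∀ i → Bf v (z i) ≡ false) → H₂.Span z v
isotropic-basis-⊥-span {k} z ind orth v v⊥ with H₂.span? _≟H_ z v
... | yes v∈ = v∈
... | no  v∉ = ⊥-elim (1+n≰n (independent-⊥-bound (k + k) (flatten′ ∘ z) (flatten v ∷ᶠ flatten ∘ z)
                 (Flatten′.h-independent flatten′-+ flatten′-ker ind)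
                 (Vec₂.∷-independent (Flatten.h-independent flatten-+ flatten-ker ind)
                                     (λ v∈ → v∉ (Flatten.h-span-reflect flatten-+ flatten-ker z v∈)))
                 orth′))
  where
  module Flatten  = AdditiveMap (hSpace k) (vecSpace (k + k)) flatten
  module Flatten′ = AdditiveMap (hSpace k) (vecSpace (k + k)) flatten′
  orth′ : ∀ i j → dot ((flatten v ∷ᶠ flatten ∘ z) j) (flatten′ (z i)) ≡ false
  orth′ i zero    = trans (sym (Bf-flatten v (z i))) (v⊥ i)
  orth′ i (suc j) = trans (sym (Bf-flatten (z j) (z i))) (orth j i)

coords : ∀ {m k} → (Fin m → H k) → H k → F2^ m
coords b v = tabulate (λ i → Bf v (b i))

coords-+ : ∀ {m k} (b : Fin m → H k) → AdditiveMap.IsAdditive (hSpace k) (vecSpace m) (coords b)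
coords-+ b u v = trans (tabulate-cong (λ i → Bf-+ˡ (b i) u v)) (tabulate-xor (λ i → Bf u (b i)) (λ i → Bf v (b i)))

coords-lc : ∀ {m d k} (b : Fin m → H k) (c : Fin d → Bool) (a : Fin d → H k) →
            coords b (H₂.lc c a) ≡ Vec₂.lc c (coords b ∘ a)
coords-lc {m} {k = k} b = AdditiveMap.h-lc (hSpace k) (vecSpace m) (coords b) (coords-+ b)

coords-⊥ : ∀ {m d k} (b : Fin m → H k) (a : Fin d → H k) → (∀ i j → Bf (a j) (b i) ≡ false) →
           ∀ c → coords b (H₂.lc c a) ≡ 0ᵥ
coords-⊥ b a a⊥b c = tabulate-false (λ i → ⊥-lc (b i) a (λ j → a⊥b i j) c)

coords-dual : ∀ {m k} (b a : Fin m → H k) → (∀ i j → Bf (a j) (b i) ≡ δ i j) →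
              ∀ x → coords b (H₂.lc (lookup x) a) ≡ x
coords-dual {k = k} b a dual x = vec-ext λ i → begin
  lookup (coords b (H₂.lc (lookup x) a)) i        ≡⟨ lookup∘tabulate _ i ⟩
  Bf (H₂.lc (lookup x) a) (b i)                   ≡⟨ AdditiveMap.h-lc (hSpace k) boolSpace (λ u → Bf u (b i)) (Bf-+ˡ (b i)) (lookup x) a ⟩
  𝔹.lc (lookup x) (λ j → Bf (a j) (b i))          ≡⟨ 𝔹.lc-congʳ (lookup x) (λ j → trans (dual i j) (δ-sym i j)) ⟩
  𝔹.lc (lookup x) (λ j → δ j i)                   ≡⟨ lc-δ (lookup x) i ⟩
  lookup x i                                      ∎
  where open ≡-Reasoning

Bf-lc-dot : ∀ {m k} (b : Fin m → H k) u x → Bf u (H₂.lc (lookup x) b) ≡ dot x (coords b u)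
Bf-lc-dot {k = k} b u x = begin
  Bf u (H₂.lc (lookup x) b)                    ≡⟨ AdditiveMap.h-lc (hSpace k) boolSpace (Bf u) (Bf-+ʳ u) (lookup x) b ⟩
  𝔹.lc (lookup x) (λ i → Bf u (b i))           ≡⟨ 𝔹.lc-congʳ (lookup x) (lookup∘tabulate (λ i → Bf u (b i))) ⟨
  𝔹.lc (lookup x) (lookup (coords b u))        ≡⟨ dot-∑ x (coords b u) ⟨
  dot x (coords b u)                           ∎
  where open ≡-Reasoning

lincomb≡lc : ∀ {d k} (c : Fin d → Bool) (e : Fin d → H k) → lincomb c e ≡ H₂.lc c e
lincomb≡lc {zero}  c e = refl
lincomb≡lc {suc d} c e = cong ((c zero ·H e zero) +H_) (lincomb≡lc (c ∘ suc) (e ∘ suc))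

lc-0ᵥ : ∀ {d k} (b : Fin d → H k) → H₂.lc (lookup 0ᵥ) b ≡ 0H
lc-0ᵥ b = H₂.∑-zero (λ i → trans (cong (_·H b i) (lookup-replicate i false)) (H₂.⊙-false (b i)))

InSpan⇒Span : ∀ {d k} (e : Fin d → H k) {v} → InSpan e v → H₂.Span e v
InSpan⇒Span e (c , p) = c , trans (sym (lincomb≡lc c e)) p

Span⇒InSpan : ∀ {d k} (e : Fin d → H k) {v} → H₂.Span e v → InSpan e v
Span⇒InSpan e (c , p) = c , trans (lincomb≡lc c e) p

LinIndep⇒Independent : ∀ {d k} (e : Fin d → H k) → LinIndep e → H₂.Independent e
LinIndep⇒Independent e ind c eq = ind c (trans (lincomb≡lc c e) eq)

isotropic : ∀ {d k} (e : Fin d → H k) → TotallySingular e → ∀ {u v} → H₂.Span e u → H₂.Span e v → Bf u v ≡ false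
isotropic e ts {u} {v} u∈ v∈ = begin
  Bf u v                       ≡⟨ cong₂ (λ s t → (s xor t) xor Bf u v) (ts u (Span⇒InSpan e u∈)) (ts v (Span⇒InSpan e v∈)) ⟨
  (Q u xor Q v) xor Bf u v     ≡⟨ Q-+ u v ⟨
  Q (u +H v)                   ≡⟨ ts (u +H v) (Span⇒InSpan e (H₂.span-⊕ {e = e} u∈ v∈)) ⟩
  false                        ∎
  where open ≡-Reasoning

true≢false : true ≢ false
true≢false ()

line-points : ∀ {k} (x y : H k) c → lincomb c (pair x y) ≡ (c zero ·H x) +H (c (suc zero) ·H y)
line-points x y c = cong ((c zero ·H x) +H_) (H₂.⊕-identityʳ (c (suc zero) ·H y))

-- Orthogonal spreads

module Spread {n : ℕ} (O : OrthogonalSpread n) where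
  open OrthogonalSpread O public

  infix 4 _∈ᴹ_
  _∈ᴹ_ : H (suc n) → Fin size → Set
  v ∈ᴹ i = H₂.Span (member i) v

  member-isotropic : ∀ i {u v} → u ∈ᴹ i → v ∈ᴹ i → Bf u v ≡ false
  member-isotropic i = isotropic (member i) (totSing i)

  member-singular : ∀ i {v} → v ∈ᴹ i → Q v ≡ false
  member-singular i {v} v∈ = totSing i v (Span⇒InSpan (member i) v∈)

  nonsingular-∉ : ∀ i {v} → Q v ≡ true → ¬ v ∈ᴹ i
  nonsingular-∉ i Qv v∈ with trans (sym Qv) (member-singular i v∈)
  ... | ()

  covering : ∀ {v} → SingularPoint v → ∃[ i ] v ∈ᴹ i
  covering {v} sv = proj₁ (cover v sv) , InSpan⇒Span (member _) (proj₂ (cover v sv))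

  members-meet-trivially : ∀ {i j u} → i ≢ j → u ∈ᴹ i → u ∈ᴹ j → u ≡ 0H
  members-meet-trivially {i} {j} {u} i≢j u∈i u∈j with u ≟H 0H
  ... | yes u≡0 = u≡0
  ... | no  u≢0 = ⊥-elim (i≢j (unique u (u≢0 , member-singular i u∈i) i j
                                       (Span⇒InSpan (member i) u∈i) (Span⇒InSpan (member j) u∈j)))

  -- A member is a maximal totally singular subspace, so it equals its own orthogonal.
  ⊥-member⇒∈ : ∀ i {v} → (∀ k → Bf v (member i k) ≡ false) → v ∈ᴹ i
  ⊥-member⇒∈ i = isotropic-basis-⊥-span (member i) (LinIndep⇒Independent (member i) (indep i))
                   (λ a b → member-isotropic i (H₂.span-member (member i) a) (H₂.span-member (member i) b)) _

  ∉⇒pivot : ∀ i {w} → ¬ w ∈ᴹ i → ∃[ k ] Bf (member i k) w ≡ true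
  ∉⇒pivot i {w} w∉ with find-true (λ k → Bf (member i k) w)
  ... | inj₁ pivot = pivot
  ... | inj₂ ⊥w   = ⊥-elim (w∉ (⊥-member⇒∈ i (λ k → trans (Bf-comm w (member i k)) (⊥w k))))

  -- The hyperplane section member i ∩ w^⊥, for w ∉ member i.
  module Section⊥ (i : Fin size) (w : H (suc n)) (w∉ : ¬ w ∈ᴹ i) =
    Pivoting.Section (hSpace (suc n)) (member i) (proj₁ (∉⇒pivot i w∉)) (λ u → Bf u w) (Bf-+ˡ w)
      (proj₂ (∉⇒pivot i w∉))

-- A hyperbolic line through the spread

module HyperbolicLine {n : ℕ} (O : OrthogonalSpread n) (N P : H (suc n))
  (N-nonsingular : NonsingularPoint N) (P-singular : SingularPoint P) (line : Hyperbolic2Space (pair N P)) where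
  open Spread O
  open ≡-Reasoning

  QN : Q N ≡ true
  QN = proj₂ N-nonsingular

  QP : Q P ≡ false
  QP = proj₂ P-singular

  Q-N+P : Q (N +H P) ≡ true xor Bf N P
  Q-N+P = trans (Q-+ N P) (cong₂ (λ s t → (s xor t) xor Bf N P) QN QP)

  -- If N ⊥ P then P would be the only singular point of the line ⟨N, P⟩.
  Bf-N-P : Bf N P ≡ true
  Bf-N-P with Bf N P in N⊥P
  ... | true  = refl
  ... | false = ⊥-elim (two-points line)
    where
    point : ∀ a b → (a ·H N) +H (b ·H P) ≢ 0H → Q ((a ·H N) +H (b ·H P)) ≡ false → (a ·H N) +H (b ·H P) ≡ P
    point false false ≢0 _  = ⊥-elim (≢0 (trans (cong₂ _+H_ (H₂.⊙-false N) (H₂.⊙-false P)) (H₂.⊕-identityˡ 0H)))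
    point false true  _  _  = trans (cong₂ _+H_ (H₂.⊙-false N) (H₂.⊙-true P)) (H₂.⊕-identityˡ P)
    point true  false _  Q≡ = ⊥-elim (true≢false (begin
      true                              ≡⟨ QN ⟨
      Q N                               ≡⟨ cong Q (trans (cong₂ _+H_ (H₂.⊙-true N) (H₂.⊙-false P)) (H₂.⊕-identityʳ N)) ⟨
      Q ((true ·H N) +H (false ·H P))   ≡⟨ Q≡ ⟩
      false                             ∎))
    point true  true  _  Q≡ = ⊥-elim (true≢false (begin
      true                              ≡⟨ cong (true xor_) N⊥P ⟨
      true xor Bf N P                   ≡⟨ Q-N+P ⟨
      Q (N +H P)                        ≡⟨ cong Q (cong₂ _+H_ (H₂.⊙-true N) (H₂.⊙-true P)) ⟨
      Q ((true ·H N) +H (true ·H P))    ≡⟨ Q≡ ⟩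
      false                             ∎))
    only-P : ∀ {v} → InSpan (pair N P) v → SingularPoint v → v ≡ P
    only-P (c , refl) (≢0 , Q≡) = trans (line-points N P c)
      (point (c zero) (c (suc zero)) (λ eq → ≢0 (trans (line-points N P c) eq)) (trans (cong Q (sym (line-points N P c))) Q≡))
    two-points : ¬ Hyperbolic2Space (pair N P)
    two-points (_ , s , t , s∈ , s-sing , t∈ , t-sing , s≢t , _) = s≢t (trans (only-P s∈ s-sing) (sym (only-P t∈ t-sing)))

  Bf-P-N : Bf P N ≡ true
  Bf-P-N = trans (Bf-comm P N) Bf-N-P

  N+P-singular : SingularPoint (N +H P)
  N+P-singular = N+P≢0 , trans Q-N+P (cong (true xor_) Bf-N-P)
    where
    N+P≢0 : N +H P ≢ 0H
    N+P≢0 eq = true≢false (trans (sym QN) (trans (cong Q (H₂.⊕≡𝟘⇒≡ eq)) QP))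

  X Y : Fin size
  X = proj₁ (covering N+P-singular)
  Y = proj₁ (covering P-singular)

  N+P∈X : N +H P ∈ᴹ X
  N+P∈X = proj₂ (covering N+P-singular)

  P∈Y : P ∈ᴹ Y
  P∈Y = proj₂ (covering P-singular)

  N∉ : ∀ i → ¬ N ∈ᴹ i
  N∉ i = nonsingular-∉ i QN

  X≢Y : X ≢ Y
  X≢Y X≡Y = N∉ Y (subst (_∈ᴹ Y) (H₂.⊕-cancelʳ N P) (H₂.span-⊕ {e = member Y} (subst (N +H P ∈ᴹ_) X≡Y N+P∈X) P∈Y))

  P∉X : ¬ P ∈ᴹ X
  P∉X P∈X = N∉ X (subst (_∈ᴹ X) (H₂.⊕-cancelʳ N P) (H₂.span-⊕ {e = member X} N+P∈X P∈X))

  module SX = Section⊥ X N (N∉ X)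
  module SY = Section⊥ Y N (N∉ Y)

  eX eY : Fin n → H (suc n)
  eX = SX.section
  eY = SY.section

  eX∈X : ∀ j → eX j ∈ᴹ X
  eX∈X = SX.section-span

  eY∈Y : ∀ j → eY j ∈ᴹ Y
  eY∈Y = SY.section-span

  eX⊥N : ∀ j → Perp N (eX j)
  eX⊥N = SX.section-kernel

  eY⊥N : ∀ j → Perp N (eY j)
  eY⊥N = SY.section-kernel

  eX⊥P : ∀ j → Perp P (eX j)
  eX⊥P j = begin
    Bf (eX j) P                               ≡⟨ cong (Bf (eX j)) N+P+N≡P ⟨
    Bf (eX j) ((N +H P) +H N)                 ≡⟨ Bf-+ʳ (eX j) (N +H P) N ⟩
    Bf (eX j) (N +H P) xor Bf (eX j) N        ≡⟨ cong₂ _xor_ (member-isotropic X (eX∈X j) N+P∈X) (eX⊥N j) ⟩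
    false                                     ∎
    where N+P+N≡P = trans (cong (_+H N) (H₂.⊕-comm N P)) (H₂.⊕-cancelʳ P N)

  eY⊥P : ∀ j → Perp P (eY j)
  eY⊥P j = member-isotropic Y (eY∈Y j) P∈Y

  Bf-N+P-N : Bf (N +H P) N ≡ true
  Bf-N+P-N = trans (Bf-+ˡ N N P) (cong₂ _xor_ (Bf-self N) Bf-P-N)

  -- A vector orthogonal to N, P, eX and eY is orthogonal to X and to Y, hence lies in X ∩ Y = 0.
  frame-⊥-zero : ∀ v → Perp N v → Perp P v → (∀ i → Bf v (eX i) ≡ false) → (∀ j → Bf v (eY j) ≡ false) → v ≡ 0H
  frame-⊥-zero v v⊥N v⊥P v⊥eX v⊥eY = members-meet-trivially X≢Y (⊥-member⇒∈ X ⊥X) (⊥-member⇒∈ Y ⊥Y)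
    where
    flip : ∀ u → Bf v u ≡ false → Bf u v ≡ false
    flip u p = trans (Bf-comm u v) p
    ⊥X : ∀ k → Bf v (member X k) ≡ false
    ⊥X k = trans (Bf-comm v _) (SX.vanishes-on-span (N +H P) N+P∈X Bf-N+P-N (λ u → Bf u v) (Bf-+ˡ v)
             (λ j → flip (eX j) (v⊥eX j)) (⊥-+ˡ N P v (flip N v⊥N) (flip P v⊥P)) (H₂.span-member (member X) k))
    ⊥Y : ∀ k → Bf v (member Y k) ≡ false
    ⊥Y k = trans (Bf-comm v _) (SY.vanishes-on-span P P∈Y Bf-P-N (λ u → Bf u v) (Bf-+ˡ v)
             (λ j → flip (eY j) (v⊥eY j)) (flip P v⊥P) (H₂.span-member (member Y) k))

  eY-independent : H₂.Independent eY
  eY-independent = SY.section-independent (LinIndep⇒Independent (member Y) (indep Y))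

  gram : Fin n → F2^ n
  gram j = coords eX (eY j)

  gram-independent : Vec₂.Independent gram
  gram-independent c eq = eY-independent c y≡0
    where
    y = H₂.lc c eY
    y∈Y : y ∈ᴹ Y
    y∈Y = H₂.span-lc (member Y) eY eY∈Y c
    y≡0 : y ≡ 0H
    y≡0 = frame-⊥-zero y (⊥-lc N eY eY⊥N c) (⊥-lc P eY eY⊥P c)
            (tabulate≡0ᵥ _ (trans (coords-lc eX c eY) eq)) (λ j → member-isotropic Y y∈Y (eY∈Y j))

  dual-coeffs : Fin n → Fin n → Bool
  dual-coeffs k = proj₁ (independent-spans gram gram-independent (unit k))

  -- The basis of Y ∩ N^⊥ dual to eX.
  f : Fin n → H (suc n)
  f k = H₂.lc (dual-coeffs k) eY

  f∈Y : ∀ k → f k ∈ᴹ Y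
  f∈Y k = H₂.span-lc (member Y) eY eY∈Y (dual-coeffs k)

  f⊥N : ∀ k → Perp N (f k)
  f⊥N k = ⊥-lc N eY eY⊥N (dual-coeffs k)

  f⊥P : ∀ k → Perp P (f k)
  f⊥P k = ⊥-lc P eY eY⊥P (dual-coeffs k)

  f-eX-dual : ∀ i k → Bf (f k) (eX i) ≡ δ i k
  f-eX-dual i k = begin
    Bf (f k) (eX i)                ≡⟨ lookup∘tabulate _ i ⟨
    lookup (coords eX (f k)) i     ≡⟨ cong (λ x → lookup x i) (trans (coords-lc eX (dual-coeffs k) eY)
                                        (proj₂ (independent-spans gram gram-independent (unit k)))) ⟩
    lookup (unit k) i              ≡⟨ lookup∘tabulate _ i ⟩
    δ i k                          ∎

  eX-f-dual : ∀ i j → Bf (eX j) (f i) ≡ δ i j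
  eX-f-dual i j = trans (Bf-comm (eX j) (f i)) (trans (f-eX-dual j i) (δ-sym j i))

  eX-isotropic : ∀ i j → Bf (eX j) (eX i) ≡ false
  eX-isotropic i j = member-isotropic X (eX∈X j) (eX∈X i)

  f-isotropic : ∀ i j → Bf (f j) (f i) ≡ false
  f-isotropic i j = member-isotropic Y (f∈Y j) (f∈Y i)

  -- Coordinates on N^⊥/N and on P^⊥/P alike.
  g : H (suc n) → H n
  g v = coords f v , coords eX v

  g-+ : AdditiveMap.IsAdditive (hSpace (suc n)) (hSpace n) g
  g-+ u v = cong₂ _,_ (coords-+ f u v) (coords-+ eX u v)

  module G = AdditiveMap (hSpace (suc n)) (hSpace n) g

  liftX liftY : F2^ n → H (suc n)
  liftX x = H₂.lc (lookup x) eX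
  liftY y = H₂.lc (lookup y) f

  lift : H n → H (suc n)
  lift (x , y) = liftX x +H liftY y

  liftX∈X : ∀ x → liftX x ∈ᴹ X
  liftX∈X x = H₂.span-lc (member X) eX eX∈X (lookup x)

  liftY∈Y : ∀ y → liftY y ∈ᴹ Y
  liftY∈Y y = H₂.span-lc (member Y) f f∈Y (lookup y)

  g-liftX : ∀ x → g (liftX x) ≡ (x , 0ᵥ)
  g-liftX x = cong₂ _,_ (coords-dual f eX eX-f-dual x) (coords-⊥ eX eX eX-isotropic (lookup x))

  g-liftY : ∀ y → g (liftY y) ≡ (0ᵥ , y)
  g-liftY y = cong₂ _,_ (coords-⊥ f f f-isotropic (lookup y)) (coords-dual eX f f-eX-dual y)

  g-lift : ∀ w → g (lift w) ≡ w
  g-lift (x , y) = trans (g-+ (liftX x) (liftY y))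
    (trans (cong₂ _+H_ (g-liftX x) (g-liftY y)) (cong₂ _,_ (Vec₂.⊕-identityʳ x) (Vec₂.⊕-identityˡ y)))

  lift⊥N : ∀ w → Perp N (lift w)
  lift⊥N (x , y) = ⊥-+ˡ (liftX x) (liftY y) N (⊥-lc N eX eX⊥N (lookup x)) (⊥-lc N f f⊥N (lookup y))

  lift⊥P : ∀ w → Perp P (lift w)
  lift⊥P (x , y) = ⊥-+ˡ (liftX x) (liftY y) P (⊥-lc P eX eX⊥P (lookup x)) (⊥-lc P f f⊥P (lookup y))

  eY-via-f : ∀ j → eY j ≡ liftY (coords eX (eY j))
  eY-via-f j = H₂.⊕≡𝟘⇒≡ (frame-⊥-zero (eY j +H y) (⊥-+ˡ (eY j) y N (eY⊥N j) (⊥-lc N f f⊥N (lookup t)))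
                          (⊥-+ˡ (eY j) y P (eY⊥P j) (⊥-lc P f f⊥P (lookup t))) (tabulate≡0ᵥ _ coords≡0) ⊥eY)
    where
    t = coords eX (eY j)
    y = liftY t
    coords≡0 : coords eX (eY j +H y) ≡ 0ᵥ
    coords≡0 = begin
      coords eX (eY j +H y)      ≡⟨ coords-+ eX (eY j) y ⟩
      t +ᵥ coords eX y           ≡⟨ cong (t +ᵥ_) (cong proj₂ (g-liftY t)) ⟩
      t +ᵥ t                     ≡⟨ Vec₂.⊕-self t ⟩
      0ᵥ                         ∎
    ⊥eY : ∀ j′ → Bf (eY j +H y) (eY j′) ≡ false
    ⊥eY j′ = member-isotropic Y (H₂.span-⊕ {e = member Y} (eY∈Y j) (liftY∈Y t)) (eY∈Y j′)

  -- N, P, eX and f form a basis of V̄.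
  frame-ext : ∀ u v → Bf u N ≡ Bf v N → Bf u P ≡ Bf v P → g u ≡ g v → u ≡ v
  frame-ext u v uN uP gu = H₂.⊕≡𝟘⇒≡ (frame-⊥-zero (u +H v)
      (trans (Bf-+ˡ N u v) (trans (cong (_xor Bf v N) uN) (xor-same (Bf v N))))
      (trans (Bf-+ˡ P u v) (trans (cong (_xor Bf v P) uP) (xor-same (Bf v P))))
      (tabulate≡0ᵥ _ (cong proj₂ g≡0))
      (λ j → trans (cong (Bf (u +H v)) (eY-via-f j))
               (trans (Bf-comm (u +H v) _) (⊥-lc (u +H v) f (λ k → trans (Bf-comm (f k) _) (tabulate≡0ᵥ _ (cong proj₁ g≡0) k))
                                                  (lookup (coords eX (eY j)))))))
    where
    g≡0 : g (u +H v) ≡ 0H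
    g≡0 = trans (g-+ u v) (trans (cong (_+H g v) gu) (H₂.⊕-self (g v)))

  g-⊥ : ∀ v → (∀ k → Bf v (f k) ≡ false) → (∀ i → Bf v (eX i) ≡ false) → g v ≡ 0H
  g-⊥ v v⊥f v⊥eX = cong₂ _,_ (tabulate-false v⊥f) (tabulate-false v⊥eX)

  g-N : g N ≡ 0H
  g-N = g-⊥ N (λ k → trans (Bf-comm N (f k)) (f⊥N k)) (λ i → trans (Bf-comm N (eX i)) (eX⊥N i))

  g-P : g P ≡ 0H
  g-P = g-⊥ P (λ k → trans (Bf-comm P (f k)) (f⊥P k)) (λ i → trans (Bf-comm P (eX i)) (eX⊥P i))

  correction : H (suc n) → H (suc n)
  correction v = (Bf v P ·H N) +H (Bf v N ·H P)

  Bf-correction : ∀ v w → Bf (correction v) w ≡ (Bf v P ∧ Bf N w) xor (Bf v N ∧ Bf P w)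
  Bf-correction v w = trans (Bf-+ˡ w (Bf v P ·H N) (Bf v N ·H P)) (cong₂ _xor_ (Bf-·ˡ (Bf v P) N w) (Bf-·ˡ (Bf v N) P w))

  g-correction : ∀ v → g (correction v) ≡ 0H
  g-correction v = begin
    g (correction v)                              ≡⟨ g-+ (Bf v P ·H N) (Bf v N ·H P) ⟩
    g (Bf v P ·H N) +H g (Bf v N ·H P)            ≡⟨ cong₂ _+H_ (G.h-⊙ g-+ (Bf v P) N) (G.h-⊙ g-+ (Bf v N) P) ⟩
    (Bf v P ·H g N) +H (Bf v N ·H g P)            ≡⟨ cong₂ (λ s t → (Bf v P ·H s) +H (Bf v N ·H t)) g-N g-P ⟩
    (Bf v P ·H 0H) +H (Bf v N ·H 0H)              ≡⟨ cong₂ _+H_ (H₂.⊙-zeroʳ (Bf v P)) (H₂.⊙-zeroʳ (Bf v N)) ⟩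
    0H +H 0H                                      ≡⟨ H₂.⊕-identityˡ 0H ⟩
    0H                                            ∎

  decomposition : ∀ v → v ≡ lift (g v) +H correction v
  decomposition v = sym (frame-ext (lift (g v) +H correction v) v pairing-N pairing-P g-agrees)
    where
    pairing-N : Bf (lift (g v) +H correction v) N ≡ Bf v N
    pairing-N = begin
      Bf (lift (g v) +H correction v) N                       ≡⟨ Bf-+ˡ N (lift (g v)) (correction v) ⟩
      Bf (lift (g v)) N xor Bf (correction v) N               ≡⟨ cong₂ _xor_ (lift⊥N (g v)) (Bf-correction v N) ⟩
      (Bf v P ∧ Bf N N) xor (Bf v N ∧ Bf P N)                 ≡⟨ cong₂ (λ s t → (Bf v P ∧ s) xor (Bf v N ∧ t)) (Bf-self N) Bf-P-N ⟩
      (Bf v P ∧ false) xor (Bf v N ∧ true)                    ≡⟨ cong₂ _xor_ (∧-zeroʳ (Bf v P)) (∧-identityʳ (Bf v N)) ⟩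
      Bf v N                                                  ∎
    pairing-P : Bf (lift (g v) +H correction v) P ≡ Bf v P
    pairing-P = begin
      Bf (lift (g v) +H correction v) P                       ≡⟨ Bf-+ˡ P (lift (g v)) (correction v) ⟩
      Bf (lift (g v)) P xor Bf (correction v) P               ≡⟨ cong₂ _xor_ (lift⊥P (g v)) (Bf-correction v P) ⟩
      (Bf v P ∧ Bf N P) xor (Bf v N ∧ Bf P P)                 ≡⟨ cong₂ (λ s t → (Bf v P ∧ s) xor (Bf v N ∧ t)) Bf-N-P (Bf-self P) ⟩
      (Bf v P ∧ true) xor (Bf v N ∧ false)                    ≡⟨ cong₂ _xor_ (∧-identityʳ (Bf v P)) (∧-zeroʳ (Bf v N)) ⟩
      Bf v P xor false                                        ≡⟨ xor-identityʳ (Bf v P) ⟩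
      Bf v P                                                  ∎
    g-agrees : g (lift (g v) +H correction v) ≡ g v
    g-agrees = begin
      g (lift (g v) +H correction v)         ≡⟨ g-+ (lift (g v)) (correction v) ⟩
      g (lift (g v)) +H g (correction v)     ≡⟨ cong₂ _+H_ (g-lift (g v)) (g-correction v) ⟩
      g v +H 0H                              ≡⟨ H₂.⊕-identityʳ (g v) ⟩
      g v                                    ∎

  liftX-0 : liftX 0ᵥ ≡ 0H
  liftX-0 = lc-0ᵥ eX

  lift-0 : lift 0H ≡ 0H
  lift-0 = trans (cong₂ _+H_ liftX-0 (lc-0ᵥ f)) (H₂.⊕-identityˡ 0H)

  decomposition-⊥N : ∀ v → Perp N v → v ≡ lift (g v) +H (Bf v P ·H N)
  decomposition-⊥N v v⊥N = begin
    v                                                   ≡⟨ decomposition v ⟩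
    lift (g v) +H ((Bf v P ·H N) +H (Bf v N ·H P))      ≡⟨ cong (λ t → lift (g v) +H ((Bf v P ·H N) +H (t ·H P))) v⊥N ⟩
    lift (g v) +H ((Bf v P ·H N) +H (false ·H P))       ≡⟨ cong (λ t → lift (g v) +H ((Bf v P ·H N) +H t)) (H₂.⊙-false P) ⟩
    lift (g v) +H ((Bf v P ·H N) +H 0H)                 ≡⟨ cong (lift (g v) +H_) (H₂.⊕-identityʳ (Bf v P ·H N)) ⟩
    lift (g v) +H (Bf v P ·H N)                         ∎

  decomposition-⊥P : ∀ v → Perp P v → v ≡ lift (g v) +H (Bf v N ·H P)
  decomposition-⊥P v v⊥P = begin
    v                                                   ≡⟨ decomposition v ⟩
    lift (g v) +H ((Bf v P ·H N) +H (Bf v N ·H P))      ≡⟨ cong (λ t → lift (g v) +H ((t ·H N) +H (Bf v N ·H P))) v⊥P ⟩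
    lift (g v) +H ((false ·H N) +H (Bf v N ·H P))       ≡⟨ cong (λ t → lift (g v) +H (t +H (Bf v N ·H P))) (H₂.⊙-false N) ⟩
    lift (g v) +H (0H +H (Bf v N ·H P))                 ≡⟨ cong (lift (g v) +H_) (H₂.⊕-identityˡ (Bf v N ·H P)) ⟩
    lift (g v) +H (Bf v N ·H P)                         ∎

  Bf-lift : ∀ u w → Bf u (lift w) ≡ dot (proj₁ w) (coords eX u) xor dot (proj₂ w) (coords f u)
  Bf-lift u (x , y) = trans (Bf-+ʳ u (liftX x) (liftY y)) (cong₂ _xor_ (Bf-lc-dot eX u x) (Bf-lc-dot f u y))

  Q-lift : ∀ w → Q (lift w) ≡ dot (proj₁ w) (proj₂ w)
  Q-lift (x , y) = begin
    Q (liftX x +H liftY y)                           ≡⟨ Q-+ (liftX x) (liftY y) ⟩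
    (Q (liftX x) xor Q (liftY y)) xor Bf (liftX x) (liftY y)
                                                     ≡⟨ cong₂ (λ s t → (s xor t) xor Bf (liftX x) (liftY y))
                                                          (member-singular X (liftX∈X x)) (member-singular Y (liftY∈Y y)) ⟩
    Bf (liftX x) (liftY y)                           ≡⟨ Bf-lc-dot f (liftX x) y ⟩
    dot y (coords f (liftX x))                       ≡⟨ cong (dot y ∘ proj₁) (g-liftX x) ⟩
    dot y x                                          ≡⟨ dot-comm y x ⟩
    dot x y                                          ∎

  β : SymForm n
  β = dotForm n

  g-kernel-N : ∀ v → Perp N v → g v ≡ 0H → v ≡ 0H ⊎ v ≡ N
  g-kernel-N v v⊥N gv = map-⊎ (trans v≡) (trans v≡) (·H-cases (Bf v P) N)
    where
    v≡ : v ≡ Bf v P ·H N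
    v≡ = begin
      v                                 ≡⟨ decomposition-⊥N v v⊥N ⟩
      lift (g v) +H (Bf v P ·H N)       ≡⟨ cong (λ w → lift w +H (Bf v P ·H N)) gv ⟩
      lift 0H +H (Bf v P ·H N)          ≡⟨ cong (_+H (Bf v P ·H N)) lift-0 ⟩
      0H +H (Bf v P ·H N)               ≡⟨ H₂.⊕-identityˡ (Bf v P ·H N) ⟩
      Bf v P ·H N                       ∎

  g-kernel-P : ∀ v → Perp P v → g v ≡ 0H → v ≡ 0H ⊎ v ≡ P
  g-kernel-P v v⊥P gv = map-⊎ (trans v≡) (trans v≡) (·H-cases (Bf v N) P)
    where
    v≡ : v ≡ Bf v N ·H P
    v≡ = begin
      v                                 ≡⟨ decomposition-⊥P v v⊥P ⟩
      lift (g v) +H (Bf v N ·H P)       ≡⟨ cong (λ w → lift w +H (Bf v N ·H P)) gv ⟩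
      lift 0H +H (Bf v N ·H P)          ≡⟨ cong (_+H (Bf v N ·H P)) lift-0 ⟩
      0H +H (Bf v N ·H P)               ≡⟨ H₂.⊕-identityˡ (Bf v N ·H P) ⟩
      Bf v N ·H P                       ∎

  g-preserves-Bf : ∀ u v → Perp N u → Perp N v → Bsymp β (g u) (g v) ≡ Bf u v
  g-preserves-Bf u v u⊥N v⊥N = sym (begin
    Bf u v                                                    ≡⟨ cong (Bf u) (decomposition-⊥N v v⊥N) ⟩
    Bf u (lift (g v) +H (Bf v P ·H N))                        ≡⟨ Bf-+ʳ u (lift (g v)) (Bf v P ·H N) ⟩
    Bf u (lift (g v)) xor Bf u (Bf v P ·H N)                  ≡⟨ cong (Bf u (lift (g v)) xor_) (trans (Bf-comm u _)
                                                                   (trans (Bf-·ˡ (Bf v P) N u) (cong (Bf v P ∧_) (trans (Bf-comm N u) u⊥N)))) ⟩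
    Bf u (lift (g v)) xor (Bf v P ∧ false)                    ≡⟨ trans (cong (Bf u (lift (g v)) xor_) (∧-zeroʳ (Bf v P))) (xor-identityʳ _) ⟩
    Bf u (lift (g v))                                         ≡⟨ Bf-lift u (g v) ⟩
    dot (coords f v) (coords eX u) xor dot (coords eX v) (coords f u)
                                                              ≡⟨ cong₂ _xor_ (dot-comm (coords f v) (coords eX u)) (dot-comm (coords eX v) (coords f u)) ⟩
    dot (coords eX u) (coords f v) xor dot (coords f u) (coords eX v)
                                                              ≡⟨ xor-comm (dot (coords eX u) (coords f v)) (dot (coords f u) (coords eX v)) ⟩
    dot (coords f u) (coords eX v) xor dot (coords eX u) (coords f v) ∎)

  Q-along : ∀ v z c → Perp z (lift (g v)) → v ≡ lift (g v) +H (c ·H z) → Q v ≡ Qb β (g v) xor (c ∧ Q z)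
  Q-along v z c lift⊥z v≡ = begin
    Q v                                                          ≡⟨ cong Q v≡ ⟩
    Q (lift (g v) +H (c ·H z))                                   ≡⟨ Q-+· (lift (g v)) z c ⟩
    (Q (lift (g v)) xor (c ∧ Q z)) xor (c ∧ Bf (lift (g v)) z)   ≡⟨ cong₂ (λ s t → (s xor (c ∧ Q z)) xor (c ∧ t)) (Q-lift (g v)) lift⊥z ⟩
    (Qb β (g v) xor (c ∧ Q z)) xor (c ∧ false)                   ≡⟨ cong ((Qb β (g v) xor (c ∧ Q z)) xor_) (∧-zeroʳ c) ⟩
    (Qb β (g v) xor (c ∧ Q z)) xor false                         ≡⟨ xor-identityʳ (Qb β (g v) xor (c ∧ Q z)) ⟩
    Qb β (g v) xor (c ∧ Q z)                                     ∎

  g-preserves-Q : ∀ v → Perp P v → Qb β (g v) ≡ Q v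
  g-preserves-Q v v⊥P = sym (begin
    Q v                                  ≡⟨ Q-along v P (Bf v N) (lift⊥P (g v)) (decomposition-⊥P v v⊥P) ⟩
    Qb β (g v) xor (Bf v N ∧ Q P)        ≡⟨ cong (λ t → Qb β (g v) xor (Bf v N ∧ t)) QP ⟩
    Qb β (g v) xor (Bf v N ∧ false)      ≡⟨ cong (Qb β (g v) xor_) (∧-zeroʳ (Bf v N)) ⟩
    Qb β (g v) xor false                 ≡⟨ xor-identityʳ (Qb β (g v)) ⟩
    Qb β (g v)                           ∎)

  Q-⊥N : ∀ u → Perp N u → Qb β (g u) ≡ Q u xor Bf u P
  Q-⊥N u u⊥N = trans (𝔹.⊕-move (sym (begin
    Q u                                  ≡⟨ Q-along u N (Bf u P) (lift⊥N (g u)) (decomposition-⊥N u u⊥N) ⟩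
    Qb β (g u) xor (Bf u P ∧ Q N)        ≡⟨ cong (λ t → Qb β (g u) xor (Bf u P ∧ t)) QN ⟩
    Qb β (g u) xor (Bf u P ∧ true)       ≡⟨ cong (Qb β (g u) xor_) (∧-identityʳ (Bf u P)) ⟩
    Qb β (g u) xor Bf u P                ∎))) (xor-comm (Bf u P) (Q u))

  symplectic : SymplecticCoord β N g
  symplectic = g-+ , (λ v v⊥N → g-kernel-N v v⊥N , λ { (inj₁ refl) → G.h-𝟘 g-+ ; (inj₂ refl) → g-N })
             , (λ w → lift w , lift⊥N w , g-lift w) , g-preserves-Bf

  quadratic : QuadraticCoord β P g
  quadratic = g-+ , (λ v v⊥P → g-kernel-P v v⊥P , λ { (inj₁ refl) → G.h-𝟘 g-+ ; (inj₂ refl) → g-P })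
            , (λ w → lift w , lift⊥P w , g-lift w) , g-preserves-Q

  image-X : SameSet (Img g (member X) N) (λ { (x , y) → y ≡ 0ᵥ })
  image-X (x , y) = (λ (u , u∈ , _ , gu) → trans (cong proj₂ (sym gu))
                                            (tabulate-false (λ i → member-isotropic X (InSpan⇒Span (member X) u∈) (eX∈X i))))
                  , (λ y≡0 → liftX x , Span⇒InSpan (member X) (liftX∈X x) , ⊥-lc N eX eX⊥N (lookup x)
                             , trans (g-liftX x) (cong (x ,_) (sym y≡0)))

  image-Y : SameSet (Img g (member Y) N) (λ { (x , y) → x ≡ 0ᵥ })
  image-Y (x , y) = (λ (u , u∈ , _ , gu) → trans (cong proj₁ (sym gu))
                                            (tabulate-false (λ k → member-isotropic Y (InSpan⇒Span (member Y) u∈) (f∈Y k))))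
                  , (λ x≡0 → liftY y , Span⇒InSpan (member Y) (liftY∈Y y) , ⊥-lc N f f⊥N (lookup y)
                             , trans (g-liftY y) (cong (_, y) (sym x≡0)))

  -- If proj₁ ∘ g is injective on member j ∩ w^⊥ (an n-space), it is bijective onto F2^ n.
  image-is-graph : ∀ j w → ¬ w ∈ᴹ j → (∀ u → u ∈ᴹ j → Perp w u → coords f u ≡ 0ᵥ → u ≡ 0H) →
                   Σ (F2^ n → F2^ n) λ L → SameSet (Img g (member j) w) (Graph β L)
  image-is-graph j w w∉ injective = L , same
    where
    open Section⊥ j w w∉
    ξ : Fin n → F2^ n
    ξ k = coords f (section k)
    ξ-independent : Vec₂.Independent ξ
    ξ-independent c eq = section-independent (LinIndep⇒Independent (member j) (indep j)) c
      (injective (H₂.lc c section) (H₂.span-lc (member j) section section-span c) (⊥-lc w section section-kernel c)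
                 (trans (coords-lc f c section) eq))
    preimage : F2^ n → H (suc n)
    preimage x = H₂.lc (proj₁ (independent-spans ξ ξ-independent x)) section
    preimage∈ : ∀ x → preimage x ∈ᴹ j
    preimage∈ x = H₂.span-lc (member j) section section-span _
    preimage⊥ : ∀ x → Perp w (preimage x)
    preimage⊥ x = ⊥-lc w section section-kernel _
    coords-preimage : ∀ x → coords f (preimage x) ≡ x
    coords-preimage x = trans (coords-lc f _ section) (proj₂ (independent-spans ξ ξ-independent x))
    L : F2^ n → F2^ n
    L x = coords eX (preimage x)
    g-preimage : ∀ x → g (preimage x) ≡ (x , L x)
    g-preimage x = cong (_, L x) (coords-preimage x)
    same : SameSet (Img g (member j) w) (Graph β L)
    same (x , y) = to , from
      where
      to : Img g (member j) w (x , y) → y ≡ L x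
      to (u , u∈ , u⊥ , gu) = trans (cong proj₂ (sym gu)) (cong (coords eX) u≡preimage)
        where
        d = u +H preimage x
        u≡preimage : u ≡ preimage x
        u≡preimage = H₂.⊕≡𝟘⇒≡ (injective d (H₂.span-⊕ {e = member j} (InSpan⇒Span (member j) u∈) (preimage∈ x))
          (⊥-+ˡ u (preimage x) w u⊥ (preimage⊥ x))
          (trans (coords-+ f u (preimage x)) (trans (cong₂ _+ᵥ_ (cong proj₁ gu) (coords-preimage x)) (Vec₂.⊕-self x))))
      from : y ≡ L x → Img g (member j) w (x , y)
      from y≡ = preimage x , Span⇒InSpan (member j) (preimage∈ x) , preimage⊥ x , trans (g-preimage x) (cong (x ,_) (sym y≡))

  graph-additive : ∀ j w (L : F2^ n → F2^ n) → SameSet (Img g (member j) w) (Graph β L) →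
                   ∀ x x′ → L (x +ᵥ x′) ≡ L x +ᵥ L x′
  graph-additive j w L same x x′ = sym (proj₁ (same (x +ᵥ x′ , L x +ᵥ L x′))
                                         (sum (proj₂ (same (x , L x)) refl) (proj₂ (same (x′ , L x′)) refl)))
    where
    sum : Img g (member j) w (x , L x) → Img g (member j) w (x′ , L x′) → Img g (member j) w (x +ᵥ x′ , L x +ᵥ L x′)
    sum (u , u∈ , u⊥ , gu) (u′ , u′∈ , u′⊥ , gu′) =
      u +H u′ , Span⇒InSpan (member j) (H₂.span-⊕ {e = member j} (InSpan⇒Span (member j) u∈) (InSpan⇒Span (member j) u′∈))
      , ⊥-+ˡ u u′ w u⊥ u′⊥ , trans (g-+ u u′) (cong₂ _+H_ gu gu′)

  ⊥P-in-Y : ∀ u → Perp P u → coords f u ≡ 0ᵥ → u ∈ᴹ Y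
  ⊥P-in-Y u u⊥P c≡0 =
    subst (_∈ᴹ Y) (sym u≡) (H₂.span-⊕ {e = member Y} (liftY∈Y (coords eX u)) (H₂.span-⊙ {e = member Y} (Bf u N) P∈Y))
    where
    u≡ : u ≡ liftY (coords eX u) +H (Bf u N ·H P)
    u≡ = begin
      u                                                       ≡⟨ decomposition-⊥P u u⊥P ⟩
      (liftX (coords f u) +H liftY (coords eX u)) +H (Bf u N ·H P) ≡⟨ cong (λ x → (liftX x +H liftY (coords eX u)) +H (Bf u N ·H P)) c≡0 ⟩
      (liftX 0ᵥ +H liftY (coords eX u)) +H (Bf u N ·H P)      ≡⟨ cong (λ t → (t +H liftY (coords eX u)) +H (Bf u N ·H P)) liftX-0 ⟩
      (0H +H liftY (coords eX u)) +H (Bf u N ·H P)            ≡⟨ cong (_+H (Bf u N ·H P)) (H₂.⊕-identityˡ (liftY (coords eX u))) ⟩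
      liftY (coords eX u) +H (Bf u N ·H P)                    ∎

  injective-P : ∀ j → j ≢ Y → ∀ u → u ∈ᴹ j → Perp P u → coords f u ≡ 0ᵥ → u ≡ 0H
  injective-P j j≢Y u u∈ u⊥P c≡0 = members-meet-trivially j≢Y u∈ (⊥P-in-Y u u⊥P c≡0)

  -- For a singular u ∈ N^⊥, Q-⊥N shows that coords f u = 0 forces u ⊥ P.
  injective-N : ∀ j → j ≢ Y → ∀ u → u ∈ᴹ j → Perp N u → coords f u ≡ 0ᵥ → u ≡ 0H
  injective-N j j≢Y u u∈ u⊥N c≡0 = injective-P j j≢Y u u∈ u⊥P c≡0
    where
    u⊥P : Bf u P ≡ false
    u⊥P = begin
      Bf u P                              ≡⟨ cong (_xor Bf u P) (member-singular j u∈) ⟨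
      Q u xor Bf u P                      ≡⟨ Q-⊥N u u⊥N ⟨
      dot (coords f u) (coords eX u)      ≡⟨ cong (λ x → dot x (coords eX u)) c≡0 ⟩
      dot 0ᵥ (coords eX u)                ≡⟨ dot-zeroˡ (coords eX u) ⟩
      false                               ∎

  Lₐ : (F2^ n → F2^ n) → F2^ n → F2^ n → F2^ n
  Lₐ L a x = L x +ᵥ E β a x

  -- M is the graph of O/P on member j; M + L vanishes on a^⊥ and has the diagonal of E_{a,a}.
  shadow-image : ∀ j → j ≢ Y → ¬ P ∈ᴹ j → (L : F2^ n → F2^ n) → SameSet (Img g (member j) N) (Graph β L) →
                 ∀ a → Alternating β (Lₐ L a) → SameSet (Img g (member j) P) (Graph β (Lₐ L a))
  shadow-image j j≢Y P∉ L SL a alt (x , y) = (λ im → trans (proj₁ (SM (x , y)) im) (M≡ x))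
                                           , (λ y≡ → proj₂ (SM (x , y)) (trans y≡ (sym (M≡ x))))
    where
    M = proj₁ (image-is-graph j P P∉ (injective-P j j≢Y))
    SM = proj₂ (image-is-graph j P P∉ (injective-P j j≢Y))
    L-diagonal : ∀ x → dot x (L x) ≡ dot x a
    L-diagonal x = trans (𝔹.⊕≡𝟘⇒≡ (trans (sym (dot-+ʳ x (L x) (E β a x))) (alt x))) (E-diagonal a x)
    M-alternating : ∀ x → dot x (M x) ≡ false
    M-alternating x = diagonal (proj₂ (SM (x , M x)) refl)
      where
      diagonal : Img g (member j) P (x , M x) → dot x (M x) ≡ false
      diagonal (u , u∈ , u⊥P , gu) =
        trans (cong (Qb β) (sym gu)) (trans (g-preserves-Q u u⊥P) (member-singular j (InSpan⇒Span (member j) u∈)))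
    agree : ∀ x → dot x a ≡ false → M x ≡ L x
    agree x xa = sym (proj₁ (SM (x , L x)) (also-⊥P (proj₂ (SL (x , L x)) refl)))
      where
      also-⊥P : Img g (member j) N (x , L x) → Img g (member j) P (x , L x)
      also-⊥P (u , u∈ , u⊥N , gu) = u , u∈ , u⊥P , gu
        where
        u⊥P : Bf u P ≡ false
        u⊥P = begin
          Bf u P              ≡⟨ cong (_xor Bf u P) (member-singular j (InSpan⇒Span (member j) u∈)) ⟨
          Q u xor Bf u P      ≡⟨ Q-⊥N u u⊥N ⟨
          Qb β (g u)          ≡⟨ cong (Qb β) gu ⟩
          dot x (L x)         ≡⟨ L-diagonal x ⟩
          dot x a             ≡⟨ xa ⟩
          false               ∎
    D : F2^ n → F2^ n
    D x = M x +ᵥ L x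
    D-+ : AdditiveMap.IsAdditive (vecSpace n) (vecSpace n) D
    D-+ x x′ = trans (cong₂ _+ᵥ_ (graph-additive j P M SM x x′) (graph-additive j N L SL x x′))
                     (Vec₂.⊕-interchange (M x) (M x′) (L x) (L x′))
    D≡E : ∀ x → D x ≡ E β a x
    D≡E = rank-one-characterisation D a D-+ (λ x xa → trans (cong (_+ᵥ L x) (agree x xa)) (Vec₂.⊕-self (L x)))
            (λ x → trans (dot-+ʳ x (M x) (L x)) (trans (cong (_xor dot x (L x)) (M-alternating x)) (L-diagonal x)))
    M≡ : ∀ x → M x ≡ Lₐ L a x
    M≡ x = Vec₂.⊕-move (D≡E x)

  members-are-shadows : ∀ j → ¬ InSpan (member j) P → ShadowMember O N β g (Img g (member j) P)
  members-are-shadows j P∉ = a , L , (j , SL) , alternating , shadow-image j j≢Y (P∉ ∘ Span⇒InSpan (member j)) L SL a alternating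
    where
    j≢Y : j ≢ Y
    j≢Y refl = P∉ (Span⇒InSpan (member Y) P∈Y)
    L = proj₁ (image-is-graph j N (N∉ j) (injective-N j j≢Y))
    SL = proj₂ (image-is-graph j N (N∉ j) (injective-N j j≢Y))
    -- member j is totally singular and g is a symplectic isometry on N^⊥.
    self-adjoint : ∀ x x′ → dot x (L x′) ≡ dot x′ (L x)
    self-adjoint x x′ =
      trans (𝔹.⊕≡𝟘⇒≡ (pairing (proj₂ (SL (x , L x)) refl) (proj₂ (SL (x′ , L x′)) refl))) (dot-comm (L x) x′)
      where
      pairing : Img g (member j) N (x , L x) → Img g (member j) N (x′ , L x′) → dot x (L x′) xor dot (L x) x′ ≡ false
      pairing (u , u∈ , u⊥N , gu) (u′ , u′∈ , u′⊥N , gu′) = begin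
        dot x (L x′) xor dot (L x) x′       ≡⟨ cong₂ (Bsymp β) gu gu′ ⟨
        Bsymp β (g u) (g u′)                ≡⟨ g-preserves-Bf u u′ u⊥N u′⊥N ⟩
        Bf u u′                             ≡⟨ member-isotropic j (InSpan⇒Span (member j) u∈) (InSpan⇒Span (member j) u′∈) ⟩
        false                               ∎
    ℓ : F2^ n → Bool
    ℓ x = dot x (L x)
    ℓ-+ : AdditiveMap.IsAdditive (vecSpace n) boolSpace ℓ
    ℓ-+ x x′ = begin
      dot (x +ᵥ x′) (L (x +ᵥ x′))                                       ≡⟨ cong (dot (x +ᵥ x′)) (graph-additive j N L SL x x′) ⟩
      dot (x +ᵥ x′) (L x +ᵥ L x′)                                       ≡⟨ dot-+ˡ (L x +ᵥ L x′) x x′ ⟩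
      dot x (L x +ᵥ L x′) xor dot x′ (L x +ᵥ L x′)                      ≡⟨ cong₂ _xor_ (dot-+ʳ x (L x) (L x′)) (dot-+ʳ x′ (L x) (L x′)) ⟩
      (ℓ x xor dot x (L x′)) xor (dot x′ (L x) xor ℓ x′)                ≡⟨ cong (λ t → (ℓ x xor t) xor (dot x′ (L x) xor ℓ x′)) (self-adjoint x x′) ⟩
      (ℓ x xor dot x′ (L x)) xor (dot x′ (L x) xor ℓ x′)                ≡⟨ 𝔹.⊕-cancel-middle (ℓ x) (dot x′ (L x)) (ℓ x′) ⟩
      ℓ x xor ℓ x′                                                      ∎
    a : F2^ n
    a = tabulate (ℓ ∘ unit)
    alternating : Alternating β (Lₐ L a)
    alternating x = begin
      dot x (L x +ᵥ E β a x)              ≡⟨ dot-+ʳ x (L x) (E β a x) ⟩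
      ℓ x xor dot x (E β a x)             ≡⟨ cong₂ _xor_ (functional-representation ℓ ℓ-+ x) (E-diagonal a x) ⟩
      dot x a xor dot x a                 ≡⟨ xor-same (dot x a) ⟩
      false                               ∎

  shadows-are-members : ∀ W → ShadowMember O N β g W → ∃[ j ] (¬ InSpan (member j) P × SameSet W (Img g (member j) P))
  shadows-are-members W (a , L , (i , SL) , alternating , SW) = by-cases (i Fin.≟ Y)
    where
    by-cases : Dec (i ≡ Y) → ∃[ j ] (¬ InSpan (member j) P × SameSet W (Img g (member j) P))
    by-cases (no i≢Y) = i , P∉ , λ v → (proj₂ (image v) ∘ proj₁ (SW v)) , (proj₂ (SW v) ∘ proj₁ (image v))
      where
      P∉ : ¬ InSpan (member i) P
      P∉ P∈ = i≢Y (unique P P-singular i Y P∈ (Span⇒InSpan (member Y) P∈Y))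
      image = shadow-image i i≢Y (P∉ ∘ Span⇒InSpan (member i)) L SL a alternating
    -- Y is the graph of L only if F2^ n is trivial, and then W and O/P are both all of H n.
    by-cases (yes i≡Y) = X , P∉X ∘ InSpan⇒Span (member X) , everything
      where
      trivial : ∀ x → x ≡ 0ᵥ
      trivial x = proj₁ (image-Y (x , L x)) (subst (λ k → Img g (member k) N (x , L x)) i≡Y (proj₂ (SL (x , L x)) refl))
      all-equal : ∀ x x′ → x ≡ x′
      all-equal x x′ = trans (trivial x) (sym (trivial x′))
      everything : SameSet W (Img g (member X) P)
      everything (x , y) = (λ _ → 0H , Span⇒InSpan (member X) (H₂.span-𝟘 (member X)) , Bf-0ˡ P
                                  , trans (G.h-𝟘 g-+) (cong₂ _,_ (all-equal 0ᵥ x) (all-equal 0ᵥ y)))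
                         , (λ _ → proj₂ (SW (x , y)) (all-equal y (Lₐ L a x)))

proposition3p20 : (n : ℕ) (O : OrthogonalSpread n) (N P : H (suc n)) →
    NonsingularPoint N → SingularPoint P → Hyperbolic2Space (pair N P) →
    IsShadowOfQuotient O N P
proposition3p20 n O N P N-nonsingular P-singular line =
  β , g , symplectic , X , Y , (X≢Y , image-X , image-Y) , g , quadratic , members-are-shadows , shadows-are-members
  where open HyperbolicLine O N P N-nonsingular P-singular line
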